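{- Let $n\ge 2$ be even and let $Q_{4n}=\langle a,b : a^{2n}=e,\ a^n=b^2,\ ba=a^{ -1}b\rangle$. Then the characteristic polynomial of the Laplacian matrix of $CSEP(Q_{4n})$ is \[\Phi(L(CSEP(Q_{4n})),x)=x(x-2)^2(x-(n+2))^{2n-2}(x-4n)^2(x-2n)^{2n-3}.\]
   Context: For a finite group $G$ and $x\in G$, $[x]$ denotes the conjugacy class of $x$. The conjugacy superenhanced power graph $CSEP(G)$ is the simple graph with vertex set $G$ in which two distinct vertices $x,y$ are adjacent iff there exist $x'\in[x]$, $y'\in[y]$ lying in a common cyclic subgroup of $G$ ($x'=y'$ permitted, so distinct conjugate elements are always adjacent). The Laplacian matrix is $L=D-A$; $\Phi(L,x)=\det(xI-L)$. -}

module Defs where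

open import Data.Nat as ℕ using (ℕ; zero; suc; _+_; _∸_; _<ᵇ_; NonZero)
open import Data.Nat.Properties using (m*n≢0)
open import Data.Nat.DivMod using (_%_)
open import Data.Bool using (Bool; true; false; if_then_else_)
open import Data.Product using (_×_; _,_; ∃-syntax)
open import Data.Fin using (Fin; zero; suc; toℕ; punchIn; _≟_)
open import Data.Integer as ℤ using (ℤ; +_; -_; _-_)
open import Relation.Nullary using (¬_; yes; no)
open import Relation.Binary.PropositionalEquality using (_≡_; _≢_)

-- The element a^i b^s (0 ≤ i < 2n, s ∈ {0,1}) is represented by (i , s)
-- with i reduced modulo 2n (s = true means the factor b is present).

QElem : Set
QElem = ℕ × Bool

module _ (n : ℕ) .{{_ : NonZero n}} where

  ord : ℕ
  ord = 2 ℕ.* n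

  md : ℕ → ℕ
  md k = _%_ k ord {{m*n≢0 2 n}}

  e : QElem
  e = (0 , false)

  -- multiplication, using b a^k = a^{-k} b and b^2 = a^n
  mul : QElem → QElem → QElem
  mul (i , false) (k , false) = (md (i + k) , false)
  mul (i , false) (k , true)  = (md (i + k) , true)
  mul (i , true)  (k , false) = (md (i + (ord ∸ k)) , true)
  mul (i , true)  (k , true)  = (md (i + (ord ∸ k) + n) , false)

  inv : QElem → QElem
  inv (i , false) = (md (ord ∸ i) , false)
  inv (i , true)  = (md (i + n) , true)

  pow : QElem → ℕ → QElem
  pow z zero    = e
  pow z (suc p) = mul z (pow z p)

  conj : QElem → QElem → QElem
  conj g x = mul (mul g x) (inv g)

  N : ℕ
  N = 4 ℕ.* n

  elt : Fin N → QElem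
  elt k = if toℕ k <ᵇ ord then (toℕ k , false) else (toℕ k ∸ ord , true)

  -- Adjacency in CSEP(Q_{4n}): distinct vertices x, y such that some
  -- x' ∈ [x], y' ∈ [y] lie in a common cyclic subgroup ⟨z⟩.
  Adj : Fin N → Fin N → Set
  Adj i j = i ≢ j ×
    ∃[ g ] ∃[ h ] ∃[ z ] ∃[ p ] ∃[ q ]
      (conj (elt g) (elt i) ≡ pow (elt z) p × conj (elt h) (elt j) ≡ pow (elt z) q)

Matrix : ℕ → Set
Matrix k = Fin k → Fin k → ℤ

Σ : ∀ k → (Fin k → ℤ) → ℤ
Σ zero    f = + 0
Σ (suc k) f = f zero ℤ.+ Σ k (λ j → f (suc j))

sign : ℕ → ℤ
sign zero          = + 1
sign (suc zero)    = - (+ 1)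
sign (suc (suc k)) = sign k

det : ∀ k → Matrix k → ℤ
det zero    M = + 1
det (suc k) M = Σ (suc k) λ j →
  sign (toℕ j) ℤ.* M zero j ℤ.* det k (λ r c → M (suc r) (punchIn j c))

δ : ∀ {k} → Fin k → Fin k → ℤ
δ i j with i ≟ j
... | yes _ = + 1
... | no  _ = + 0

laplacian : ∀ k → Matrix k → Matrix k
laplacian k A i j = δ i j ℤ.* Σ k (A i) - A i j

charPoly : ∀ k → Matrix k → ℤ → ℤ
charPoly k L x = det k (λ i j → x ℤ.* δ i j - L i j)

IsAdjMatrix : ∀ k → (Fin k → Fin k → Set) → Matrix k → Set
IsAdjMatrix k R A = ∀ i j → (A i j ≡ + 1 × R i j) Data.Sum.⊎ (A i j ≡ + 0 × ¬ R i j)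
  where import Data.Sum

-- Sort the vertices of CSEP(Q_4n) into four classes: the centre {e, a^n}, the other 2n - 2
-- powers of a, and (n being even) the conjugacy classes {a^(2i) b} and {a^(2i+1) b}, each of size n.
-- Conjugation preserves these classes and the powers of one element meet at most one non-central
-- class, so adjacency depends only on the classes: every class is a clique, the centre is joined to
-- everything and the three other classes are pairwise non-adjacent. Thus x I - L is a matrix
-- diag (g (t i)) + F (t i) (t j) determined by the class t i of each vertex. Its determinant is
-- computed by induction on the number of vertices: two vertices of one class give the recurrence of
-- det (g I + J), and vertices of pairwise distinct classes form an arrow around the central one.
-- The result is a polynomial in det (g_c I + J) and the cofactor sums of these blocks, whose closed
-- forms g^(m-1) (g + m) and m g^(m-1) multiply out to the stated factorisation.

module Submission where

open import Defs
open import Data.Nat as ℕ using (ℕ; zero; suc; NonZero; _≤_; s≤s; z≤n)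
open import Data.Nat.Divisibility using (_∣_)
import Data.Nat.Properties as ℕP
open import Data.Integer as ℤ using (ℤ; +_)
open import Data.Fin using (Fin; zero; suc; toℕ; punchIn; punchOut; _≟_; inject₁)
open import Data.Fin.Properties
  using (toℕ-inject₁; punchInᵢ≢i; punchIn-injective; punchOut-cong; punchOut-punchIn; punchIn-punchOut; suc-injective; any?; 0≢1+n)
open import Data.Product using (∃₂; _×_; _,_; proj₁)
open import Data.Sum using (_⊎_; inj₁; inj₂)
open import Data.Empty using (⊥-elim)
open import Data.Vec.Functional using (head; tail)
open import Function using (_∘_)
open import Relation.Binary.PropositionalEquality
open import Relation.Nullary using (yes; no; ¬_; Dec; ¬?; _×-dec_)

δ-refl : ∀ {k} (a : Fin k) → δ a a ≡ + 1
δ-refl a with a ≟ a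
... | yes _   = refl
... | no  a≢a = ⊥-elim (a≢a refl)

δ-≢ : ∀ {k} {a b : Fin k} → a ≢ b → δ a b ≡ + 0
δ-≢ {a = a} {b} a≢b with a ≟ b
... | yes a≡b = ⊥-elim (a≢b a≡b)
... | no  _   = refl

δ-injective : ∀ {k l} (f : Fin k → Fin l) → (∀ a b → f a ≡ f b → a ≡ b) → ∀ a b → δ (f a) (f b) ≡ δ a b
δ-injective f f-inj a b with a ≟ b
... | yes refl = δ-refl (f a)
... | no  a≢b  = δ-≢ (a≢b ∘ f-inj a b)

Class : Set
Class = Fin 4

pattern central    = zero
pattern rotation   = suc zero
pattern reflection₀ = suc (suc zero)
pattern reflection₁ = suc (suc (suc zero))

starAdj : Class → Class → ℤ
starAdj central _             = + 1
starAdj (suc a) central       = + 1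
starAdj (suc a) (suc b)       = δ a b

starAdj-refl : ∀ c → starAdj c c ≡ + 1
starAdj-refl central     = refl
starAdj-refl rotation    = refl
starAdj-refl reflection₀ = refl
starAdj-refl reflection₁ = refl

starAdj-01 : ∀ a b → starAdj a b ≡ + 0 ⊎ starAdj a b ≡ + 1
starAdj-01 central b             = inj₂ refl
starAdj-01 (suc a) central       = inj₂ refl
starAdj-01 (suc a) (suc b) with a ≟ b
... | yes _ = inj₂ refl
... | no  _ = inj₁ refl

starAdj-centralʳ : ∀ c → starAdj c central ≡ + 1
starAdj-centralʳ central = refl
starAdj-centralʳ (suc c) = refl

starAdj-≢ : ∀ {a b} → a ≢ central → b ≢ central → a ≢ b → starAdj a b ≡ + 0
starAdj-≢ {central}         a≢0 _   _   = ⊥-elim (a≢0 refl)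
starAdj-≢ {suc a} {central} _   b≢0 _   = ⊥-elim (b≢0 refl)
starAdj-≢ {suc a} {suc b}   _   _   a≢b = δ-≢ (a≢b ∘ cong suc)

indicator : Class → Class → ℕ
indicator a b with a ≟ b
... | yes _ = 1
... | no  _ = 0

addOne : Class → (Class → ℕ) → Class → ℕ
addOne c m c′ = indicator c c′ ℕ.+ m c′

occurrences : ∀ {k} → (Fin k → Class) → Class → ℕ
occurrences {zero}  t c = 0
occurrences {suc k} t = addOne (head t) (occurrences (tail t))

occurrences-cong : ∀ k {t u : Fin k → Class} → (∀ i → t i ≡ u i) → ∀ c → occurrences t c ≡ occurrences u c
occurrences-cong zero    t≗u c = refl
occurrences-cong (suc k) t≗u c =
  cong₂ ℕ._+_ (cong (λ a → indicator a c) (t≗u zero)) (occurrences-cong k (t≗u ∘ suc) c)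

occurrences-absent : ∀ k (t : Fin k → Class) c → (∀ i → t i ≢ c) → occurrences t c ≡ 0
occurrences-absent zero    t c t≢c = refl
occurrences-absent (suc k) t c t≢c = cong₂ ℕ._+_ indicator-≢ (occurrences-absent k (tail t) c (t≢c ∘ suc))
  where
  indicator-≢ : indicator (t zero) c ≡ 0
  indicator-≢ with t zero ≟ c
  ... | yes t₀≡c = ⊥-elim (t≢c zero t₀≡c)
  ... | no  _    = refl

module DicyclicGroup where

  open import Data.Nat
  open import Data.Nat.Properties
  open import Data.Nat.DivMod
  open import Data.Nat.Divisibility
  open import Data.Nat.Tactic.RingSolver using (solve-∀)
  open import Data.Bool using (true; false; T; if_then_else_)
  open import Data.Product using (∃; ∃-syntax)
  open import Data.Fin as F using ()
  open import Data.Fin.Properties using (toℕ<n; toℕ-fromℕ<)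

  module Congruence (d : ℕ) .{{_ : NonZero d}} where

    infix 4 _≈_
    _≈_ : ℕ → ℕ → Set
    a ≈ b = a % d ≡ b % d

    +-cong-≈ : ∀ a a′ b b′ → a ≈ a′ → b ≈ b′ → a + b ≈ a′ + b′
    +-cong-≈ a a′ b b′ a≈a′ b≈b′ = begin
      (a + b) % d             ≡⟨ %-distribˡ-+ a b d ⟩
      (a % d + b % d) % d     ≡⟨ cong₂ (λ x y → (x + y) % d) a≈a′ b≈b′ ⟩
      (a′ % d + b′ % d) % d   ≡⟨ %-distribˡ-+ a′ b′ d ⟨
      (a′ + b′) % d           ∎
      where open ≡-Reasoning

    %-≈ : ∀ {m} .{{_ : NonZero m}} → d ∣ m → ∀ a → a % m ≈ a
    %-≈ {m} d∣m a = m∣n⇒o%n%m≡o%m d m a d∣m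

    ∣⇒≈0 : ∀ {a} → d ∣ a → a ≈ 0
    ∣⇒≈0 {a} d∣a = trans (n∣m⇒m%n≡0 a d d∣a) (sym (n∣m⇒m%n≡0 0 d (d ∣0)))

    ≈0⇒∣ : ∀ {a} → a ≈ 0 → d ∣ a
    ≈0⇒∣ {a} a≈0 = m%n≡0⇒n∣m a d (trans a≈0 (n∣m⇒m%n≡0 0 d (d ∣0)))

    +-identityʳ-≈ : ∀ a b → b ≈ 0 → a + b ≈ a
    +-identityʳ-≈ a b b≈0 = trans (+-cong-≈ a a b 0 refl b≈0) (cong (_% d) (+-identityʳ a))

    ∣-+-cancelˡ : ∀ {a b} → a + b ≈ 0 → d ∣ a → d ∣ b
    ∣-+-cancelˡ {a} {b} a+b≈0 d∣a = ≈0⇒∣ (trans (sym (+-cong-≈ a 0 b b (∣⇒≈0 d∣a) refl)) a+b≈0)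

    ≈-∣ : ∀ {a b} → a ≈ b → d ∣ a → d ∣ b
    ≈-∣ a≈b d∣a = ≈0⇒∣ (trans (sym a≈b) (∣⇒≈0 d∣a))

    ≈⇒≡ : ∀ {a b} → a ≈ b → a < d → b < d → a ≡ b
    ≈⇒≡ a≈b a<d b<d = trans (sym (m<n⇒m%n≡m a<d)) (trans a≈b (m<n⇒m%n≡m b<d))

    ∸+≈0 : ∀ m v → v ≤ m → d ∣ m → (m ∸ v) + v ≈ 0
    ∸+≈0 m v v≤m d∣m = trans (cong (_% d) (m∸n+n≡m v≤m)) (∣⇒≈0 d∣m)

    byDivisibility : Class → Class → ℕ → Class
    byDivisibility c c′ r with d ∣? r
    ... | yes _ = c
    ... | no  _ = c′

    byDivisibility-∣ : ∀ {c c′ r} → d ∣ r → byDivisibility c c′ r ≡ c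
    byDivisibility-∣ {r = r} d∣r with d ∣? r
    ... | yes _   = refl
    ... | no  d∤r = ⊥-elim (d∤r d∣r)

    byDivisibility-∤ : ∀ {c c′ r} → ¬ d ∣ r → byDivisibility c c′ r ≡ c′
    byDivisibility-∤ {r = r} d∤r with d ∣? r
    ... | yes d∣r = ⊥-elim (d∤r d∣r)
    ... | no  _   = refl

    byDivisibility-cong : ∀ {c c′ a b} → (d ∣ a → d ∣ b) → (d ∣ b → d ∣ a) →
      byDivisibility c c′ a ≡ byDivisibility c c′ b
    byDivisibility-cong {a = a} {b} a⇒b b⇒a with d ∣? a | d ∣? b
    ... | yes _   | yes _   = refl
    ... | yes d∣a | no  d∤b = ⊥-elim (d∤b (a⇒b d∣a))
    ... | no  d∤a | yes d∣b = ⊥-elim (d∤a (b⇒a d∣b))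
    ... | no  _   | no  _   = refl

    byDivisibility-≈ : ∀ {c c′ a b} → a ≈ b → byDivisibility c c′ a ≡ byDivisibility c c′ b
    byDivisibility-≈ a≈b = byDivisibility-cong (≈-∣ a≈b) (≈-∣ (sym a≈b))

    byDivisibility-neg : ∀ {c c′ a b} → a + b ≈ 0 → byDivisibility c c′ a ≡ byDivisibility c c′ b
    byDivisibility-neg {a = a} {b} a+b≈0 =
      byDivisibility-cong (∣-+-cancelˡ a+b≈0) (∣-+-cancelˡ (trans (cong (_% d) (+-comm b a)) a+b≈0))

  %-≡-divisor : ∀ {n m} .{{_ : NonZero n}} .{{_ : NonZero m}} → m ∣ n → ∀ {a b} → a % n ≡ b % n → a % m ≡ b % m
  %-≡-divisor {n} {m} m∣n {a} {b} eq =
    trans (sym (m∣n⇒o%n%m≡o%m m n a m∣n)) (trans (cong (_% m) eq) (m∣n⇒o%n%m≡o%m m n b m∣n))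

  module Dicyclic (n : ℕ) .{{_ : NonZero n}} (n-even : 2 ∣ n) where

    M : ℕ
    M = ord n

    instance
      M-nonZero : NonZero M
      M-nonZero = m*n≢0 2 n

    n∣M : n ∣ M
    n∣M = divides 2 refl

    2∣M : 2 ∣ M
    2∣M = divides n (*-comm 2 n)

    module Mod-n = Congruence n
    module Mod-2 = Congruence 2
    module Mod-M = Congruence M

    -- a^r is central iff n ∣ r; a^r b is conjugate to b or to ab according to the parity of r.
    rotationClass reflectionClass : ℕ → Class
    rotationClass   = Mod-n.byDivisibility central rotation
    reflectionClass = Mod-2.byDivisibility reflection₀ reflection₁

    rotationClass-≈ : ∀ {a b} → a Mod-n.≈ b → rotationClass a ≡ rotationClass b
    rotationClass-≈ {a} {b} = Mod-n.byDivisibility-≈ {central} {rotation} {a} {b}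

    rotationClass-neg : ∀ {a b} → a + b Mod-n.≈ 0 → rotationClass a ≡ rotationClass b
    rotationClass-neg {a} {b} = Mod-n.byDivisibility-neg {central} {rotation} {a} {b}

    reflectionClass-≈ : ∀ {a b} → a Mod-2.≈ b → reflectionClass a ≡ reflectionClass b
    reflectionClass-≈ {a} {b} = Mod-2.byDivisibility-≈ {reflection₀} {reflection₁} {a} {b}

    reflectionClass-neg : ∀ {a b} → a + b Mod-2.≈ 0 → reflectionClass a ≡ reflectionClass b
    reflectionClass-neg {a} {b} = Mod-2.byDivisibility-neg {reflection₀} {reflection₁} {a} {b}

    classOf : QElem → Class
    classOf (r , false) = rotationClass r
    classOf (r , true)  = reflectionClass r

    classOf-conj-rotation-rotation : ∀ h r → h < M → r < M → classOf (conj n (h , false) (r , false)) ≡ classOf (r , false)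
    classOf-conj-rotation-rotation h r h<M _ = rotationClass-≈ (begin
        md n (md n (h + r) + md n (M ∸ h)) % n
          ≡⟨ Mod-n.%-≈ n∣M _ ⟩
        (md n (h + r) + md n (M ∸ h)) % n
          ≡⟨ Mod-n.+-cong-≈ _ _ _ _ (Mod-n.%-≈ n∣M (h + r)) (Mod-n.%-≈ n∣M (M ∸ h)) ⟩
        (h + r + (M ∸ h)) % n
          ≡⟨ cong (_% n) (ring h r (M ∸ h)) ⟩
        (r + ((M ∸ h) + h)) % n
          ≡⟨ Mod-n.+-identityʳ-≈ _ _ (Mod-n.∸+≈0 M h (<⇒≤ h<M) n∣M) ⟩
        r % n ∎)
      where
      open ≡-Reasoning
      ring : ∀ a b c → a + b + c ≡ b + (c + a)
      ring = solve-∀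

    -- Conjugation by a^h b sends a^r to a^(-r) and a^r b to a^(2h - r) b.
    classOf-conj-reflection-rotation : ∀ h r → h < M → r < M → classOf (conj n (h , true) (r , false)) ≡ classOf (r , false)
    classOf-conj-reflection-rotation h r _ r<M = rotationClass-neg (begin
        (md n (md n (h + (M ∸ r)) + (M ∸ u) + n) + r) % n
          ≡⟨ Mod-n.+-cong-≈ _ _ r r (Mod-n.%-≈ n∣M _) refl ⟩
        (md n (h + (M ∸ r)) + (M ∸ u) + n + r) % n
          ≡⟨ Mod-n.+-cong-≈ _ _ r r
               (Mod-n.+-cong-≈ _ _ n n (Mod-n.+-cong-≈ _ _ (M ∸ u) (M ∸ u) (Mod-n.%-≈ n∣M (h + (M ∸ r))) refl) refl) refl ⟩
        (h + (M ∸ r) + (M ∸ u) + n + r) % n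
          ≡⟨ cong (_% n) (ring h (M ∸ r) (M ∸ u) n r) ⟩
        ((M ∸ u) + (h + n) + ((M ∸ r) + r)) % n
          ≡⟨ Mod-n.+-cong-≈ _ _ _ 0 (Mod-n.+-cong-≈ (M ∸ u) (M ∸ u) (h + n) u refl (sym (Mod-n.%-≈ n∣M (h + n))))
                                    (Mod-n.∸+≈0 M r (<⇒≤ r<M) n∣M) ⟩
        ((M ∸ u) + u + 0) % n
          ≡⟨ Mod-n.+-cong-≈ _ 0 0 0 (Mod-n.∸+≈0 M u (<⇒≤ (m%n<n (h + n) M)) n∣M) refl ⟩
        0 % n ∎)
      where
      open ≡-Reasoning
      u = md n (h + n)
      ring : ∀ a b c d e → a + b + c + d + e ≡ c + (a + d) + (b + e)
      ring = solve-∀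

    classOf-conj-rotation-reflection : ∀ h r → h < M → r < M → classOf (conj n (h , false) (r , true)) ≡ classOf (r , true)
    classOf-conj-rotation-reflection h r h<M _ = reflectionClass-≈ (begin
        md n (A + (M ∸ v)) % 2
          ≡⟨ Mod-2.%-≈ 2∣M (A + (M ∸ v)) ⟩
        (A + (M ∸ v)) % 2
          ≡⟨ Mod-2.+-cong-≈ A (h + r) (M ∸ v) (M ∸ v) (Mod-2.%-≈ 2∣M (h + r)) refl ⟩
        (h + r + (M ∸ v)) % 2
          ≡⟨ sym (Mod-2.+-identityʳ-≈ (h + r + (M ∸ v)) ((M ∸ h) + h) (Mod-2.∸+≈0 M h (<⇒≤ h<M) 2∣M)) ⟩
        (h + r + (M ∸ v) + ((M ∸ h) + h)) % 2
          ≡⟨ cong (_% 2) (ring h r (M ∸ v) (M ∸ h)) ⟩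
        (r + ((M ∸ v) + (M ∸ h)) + (h + h)) % 2
          ≡⟨ Mod-2.+-cong-≈ (r + ((M ∸ v) + (M ∸ h))) (r + ((M ∸ v) + v)) (h + h) 0
               (Mod-2.+-cong-≈ r r ((M ∸ v) + (M ∸ h)) ((M ∸ v) + v) refl
                 (Mod-2.+-cong-≈ (M ∸ v) (M ∸ v) (M ∸ h) v refl (sym (Mod-2.%-≈ 2∣M (M ∸ h)))))
               (Mod-2.∣⇒≈0 (divides h (double h))) ⟩
        (r + ((M ∸ v) + v) + 0) % 2
          ≡⟨ Mod-2.+-identityʳ-≈ (r + ((M ∸ v) + v)) 0 refl ⟩
        (r + ((M ∸ v) + v)) % 2
          ≡⟨ Mod-2.+-identityʳ-≈ r ((M ∸ v) + v) (Mod-2.∸+≈0 M v (<⇒≤ (m%n<n (M ∸ h) M)) 2∣M) ⟩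
        r % 2 ∎)
      where
      open ≡-Reasoning
      A = md n (h + r)
      v = md n (M ∸ h)
      ring : ∀ a b c d → a + b + c + (d + a) ≡ b + (c + d) + (a + a)
      ring = solve-∀
      double : ∀ h → h + h ≡ h * 2
      double = solve-∀

    classOf-conj-reflection-reflection : ∀ h r → h < M → r < M → classOf (conj n (h , true) (r , true)) ≡ classOf (r , true)
    classOf-conj-reflection-reflection h r _ r<M = reflectionClass-neg (begin
        (md n (A + B) + r) % 2
          ≡⟨ Mod-2.+-cong-≈ (md n (A + B)) (A + B) r r (Mod-2.%-≈ 2∣M (A + B)) refl ⟩
        (A + B + r) % 2
          ≡⟨ Mod-2.+-cong-≈ (A + B) (h + (M ∸ r) + n + (h + n)) r r
               (Mod-2.+-cong-≈ A (h + (M ∸ r) + n) B (h + n) (Mod-2.%-≈ 2∣M (h + (M ∸ r) + n)) (Mod-2.%-≈ 2∣M (h + n))) refl ⟩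
        (h + (M ∸ r) + n + (h + n) + r) % 2
          ≡⟨ cong (_% 2) (ring h (M ∸ r) n r) ⟩
        ((M ∸ r) + r + (h + n) * 2) % 2
          ≡⟨ Mod-2.+-identityʳ-≈ ((M ∸ r) + r) ((h + n) * 2) (Mod-2.∣⇒≈0 (divides (h + n) refl)) ⟩
        ((M ∸ r) + r) % 2
          ≡⟨ Mod-2.∸+≈0 M r (<⇒≤ r<M) 2∣M ⟩
        0 % 2 ∎)
      where
      open ≡-Reasoning
      A = md n (h + (M ∸ r) + n)
      B = md n (h + n)
      ring : ∀ a b c d → a + b + c + (a + c) + d ≡ b + d + (a + c) * 2
      ring = solve-∀

    classOf-conj : ∀ g x → proj₁ g < M → proj₁ x < M → classOf (conj n g x) ≡ classOf x
    classOf-conj (h , false) (r , false) = classOf-conj-rotation-rotation h r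
    classOf-conj (h , true)  (r , false) = classOf-conj-reflection-rotation h r
    classOf-conj (h , false) (r , true)  = classOf-conj-rotation-reflection h r
    classOf-conj (h , true)  (r , true)  = classOf-conj-reflection-reflection h r

    rotationPower : ∀ r p → ∃ λ v → pow n (r , false) p ≡ (v , false)
    rotationPower r zero = 0 , refl
    rotationPower r (suc p) with rotationPower r p
    ... | v , eq rewrite eq = md n (r + v) , refl

    ReflectionPower : ℕ → QElem → Set
    ReflectionPower r (v , false) = n ∣ v × v < M
    ReflectionPower r (v , true)  = v Mod-n.≈ r × v < M

    reflectionPower : ∀ r p → ReflectionPower r (pow n (r , true) p)
    reflectionPower r zero    = n ∣0 , >-nonZero⁻¹ M
    reflectionPower r (suc p) = step (pow n (r , true) p) (reflectionPower r p)
      where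
      step : ∀ w → ReflectionPower r w → ReflectionPower r (mul n (r , true) w)
      step (v , false) (n∣v , v<M) = v′≈r , m%n<n _ M
        where
        v′≈r : md n (r + (M ∸ v)) Mod-n.≈ r
        v′≈r = trans (Mod-n.%-≈ n∣M (r + (M ∸ v)))
          (Mod-n.+-identityʳ-≈ r (M ∸ v)
            (trans (sym (Mod-n.+-identityʳ-≈ (M ∸ v) v (Mod-n.∣⇒≈0 n∣v))) (Mod-n.∸+≈0 M v (<⇒≤ v<M) n∣M)))
      step (v , true) (v≈r , v<M) = Mod-n.≈0⇒∣ v′≈0 , m%n<n _ M
        where
        v′≈0 : md n (r + (M ∸ v) + n) Mod-n.≈ 0
        v′≈0 = trans (Mod-n.%-≈ n∣M (r + (M ∸ v) + n))
          (trans (Mod-n.+-identityʳ-≈ (r + (M ∸ v)) n (Mod-n.∣⇒≈0 ∣-refl))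
            (trans (Mod-n.+-cong-≈ r v (M ∸ v) (M ∸ v) (sym v≈r) refl)
              (trans (cong (_% n) (+-comm v (M ∸ v))) (Mod-n.∸+≈0 M v (<⇒≤ v<M) n∣M))))

    CentralOr : Class → Class → Set
    CentralOr c a = a ≡ central ⊎ a ≡ c

    starAdj-centralOr : ∀ {c a b} → CentralOr c a → CentralOr c b → starAdj a b ≡ + 1
    starAdj-centralOr {a = a} (inj₁ refl) _           = refl
    starAdj-centralOr {a = a} (inj₂ _)    (inj₁ refl) = starAdj-centralʳ a
    starAdj-centralOr {c}     (inj₂ refl) (inj₂ refl) = starAdj-refl c

    rotationClass-cases : ∀ s → CentralOr rotation (rotationClass s)
    rotationClass-cases s with n ∣? s
    ... | yes _ = inj₁ refl
    ... | no  _ = inj₂ refl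

    powerClass : QElem → Class
    powerClass (_ , false) = rotation
    powerClass (r , true)  = reflectionClass r

    classOf-pow : ∀ z p → CentralOr (powerClass z) (classOf (pow n z p))
    classOf-pow (r , false) p with rotationPower r p
    ... | v , eq rewrite eq = rotationClass-cases v
    classOf-pow (r , true) p = reflection (pow n (r , true) p) (reflectionPower r p)
      where
      reflection : ∀ w → ReflectionPower r w → CentralOr (reflectionClass r) (classOf w)
      reflection (v , false) (n∣v , _) = inj₁ (Mod-n.byDivisibility-∣ n∣v)
      reflection (v , true)  (v≈r , _) = inj₂ (reflectionClass-≈ (%-≡-divisor n-even v≈r))

    elt-bounded : ∀ k → proj₁ (elt n k) < M
    elt-bounded k with toℕ k <ᵇ M in eq
    ... | true = <ᵇ⇒< (toℕ k) M (subst T (sym eq) _)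
    ... | false = m<n+o⇒m∸n<o (toℕ k) M (subst (toℕ k <_) (ar n) (toℕ<n k))
      where
      ar : ∀ n → 4 * n ≡ 2 * n + 2 * n
      ar = solve-∀

    vertexClass : Fin (N n) → Class
    vertexClass k = classOf (elt n k)

    Adj⇒starAdj : ∀ i j → Adj n i j → starAdj (vertexClass i) (vertexClass j) ≡ + 1
    Adj⇒starAdj i j (_ , g , h , z , p , q , e1 , e2) = begin
      starAdj (classOf (elt n i)) (classOf (elt n j))
        ≡⟨ cong₂ starAdj (sym (classOf-conj (elt n g) (elt n i) (elt-bounded g) (elt-bounded i)))
                      (sym (classOf-conj (elt n h) (elt n j) (elt-bounded h) (elt-bounded j))) ⟩
      starAdj (classOf (conj n (elt n g) (elt n i))) (classOf (conj n (elt n h) (elt n j)))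
        ≡⟨ cong₂ starAdj (cong classOf e1) (cong classOf e2) ⟩
      starAdj (classOf (pow n (elt n z) p)) (classOf (pow n (elt n z) q))
        ≡⟨ starAdj-centralOr (classOf-pow (elt n z) p) (classOf-pow (elt n z) q) ⟩
      + 1 ∎
      where open ≡-Reasoning

    <M⇒<N : ∀ {r} → r < M → r < N n
    <M⇒<N {r} r<M = <-≤-trans r<M (subst (M ≤_) (ring n) (m≤m+n M M))
      where ring : ∀ n → 2 * n + 2 * n ≡ 4 * n
            ring = solve-∀

    elt-rotation : ∀ k → toℕ k < M → elt n k ≡ (toℕ k , false)
    elt-rotation k k<M with toℕ k <ᵇ M in eq
    ... | true  = refl
    ... | false = ⊥-elim (subst T eq (<⇒<ᵇ k<M))

    rotationIndex : ∀ r → r < M → Fin (N n)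
    rotationIndex r r<M = F.fromℕ< (<M⇒<N r<M)

    elt-rotationIndex : ∀ r (r<M : r < M) → elt n (rotationIndex r r<M) ≡ (r , false)
    elt-rotationIndex r r<M = trans (elt-rotation (rotationIndex r r<M) (subst (_< M) (sym (toℕ-fromℕ< (<M⇒<N r<M))) r<M))
                                    (cong (_, false) (toℕ-fromℕ< (<M⇒<N r<M)))

    n<M : n < M
    n<M = subst (n <_) (ring n) (m<m+n n (>-nonZero⁻¹ n))
      where ring : ∀ n → n + n ≡ 2 * n
            ring = solve-∀

    md-< : ∀ {r} → r < M → md n r ≡ r
    md-< = m<n⇒m%n≡m

    md-+M : ∀ r → r < M → md n (r + M) ≡ r
    md-+M r r<M = trans ([m+n]%n≡m%n r M) (md-< r<M)

    conj-e : ∀ x → proj₁ x < M → conj n (e n) x ≡ x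
    conj-e (r , false) r<M = cong (_, false) (Mod-M.≈⇒≡
        (trans (Mod-M.%-≈ ∣-refl _)
          (trans (Mod-M.+-cong-≈ (md n r) r (md n (M ∸ 0)) 0 (Mod-M.%-≈ ∣-refl r)
                                 (trans (Mod-M.%-≈ ∣-refl M) (Mod-M.∣⇒≈0 ∣-refl)))
            (cong (_% M) (+-identityʳ r))))
        (m%n<n _ M) r<M)
    conj-e (r , true) r<M = cong (_, true) (trans (cong (λ z → md n (md n r + (M ∸ z))) (n%n≡0 M))
        (trans (cong (λ z → md n (z + M)) (md-< r<M)) (md-+M r r<M)))

    pow-a : ∀ p → p < M → pow n (1 , false) p ≡ (p , false)
    pow-a zero    p<M = refl
    pow-a (suc p) p<M rewrite pow-a p (<-trans (n<1+n p) p<M) = cong (_, false) (md-< p<M)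

    pow-b¹ : ∀ r → r < M → pow n (r , true) 1 ≡ (r , true)
    pow-b¹ r r<M = cong (_, true) (md-+M r r<M)

    pow-b² : ∀ r → r < M → pow n (r , true) 2 ≡ (n , false)
    pow-b² r r<M = cong (_, false)
      (trans (cong (λ z → md n (r + (M ∸ z) + n)) (md-+M r r<M))
        (trans (cong (λ z → md n (z + n)) (m+[n∸m]≡n (<⇒≤ r<M)))
          (trans (cong (_% M) (+-comm M n)) (md-+M n n<M))))

    conj-a-b : ∀ d r s → d < M → s < M → (r + d + d) Mod-M.≈ s → conj n (d , false) (r , true) ≡ (s , true)
    conj-a-b d r s d<M s<M r+2d≈s = cong (_, true) (Mod-M.≈⇒≡ conj≈s (m%n<n _ M) s<M)
      where
      v = md n (M ∸ d)
      M∸v≈d : (M ∸ v) Mod-M.≈ d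
      M∸v≈d = begin
        (M ∸ v) % M                     ≡⟨ Mod-M.+-identityʳ-≈ (M ∸ v) ((M ∸ d) + d) (Mod-M.∸+≈0 M d (<⇒≤ d<M) ∣-refl) ⟨
        ((M ∸ v) + ((M ∸ d) + d)) % M   ≡⟨ cong (_% M) (+-assoc (M ∸ v) (M ∸ d) d) ⟨
        ((M ∸ v) + (M ∸ d) + d) % M     ≡⟨ Mod-M.+-cong-≈ _ ((M ∸ v) + v) d d
                                             (Mod-M.+-cong-≈ (M ∸ v) (M ∸ v) (M ∸ d) v refl (sym (Mod-M.%-≈ ∣-refl (M ∸ d)))) refl ⟩
        ((M ∸ v) + v + d) % M           ≡⟨ Mod-M.+-cong-≈ ((M ∸ v) + v) 0 d d (Mod-M.∸+≈0 M v (<⇒≤ (m%n<n (M ∸ d) M)) ∣-refl) refl ⟩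
        d % M                           ∎
        where open ≡-Reasoning
      conj≈s : md n (md n (d + r) + (M ∸ v)) Mod-M.≈ s
      conj≈s = trans (Mod-M.%-≈ ∣-refl _)
        (trans (Mod-M.+-cong-≈ (md n (d + r)) (d + r) (M ∸ v) d (Mod-M.%-≈ ∣-refl (d + r)) M∸v≈d)
          (trans (cong (_% M) (ring d r)) r+2d≈s))
        where ring : ∀ d r → d + r + d ≡ r + d + d
              ring = solve-∀

    %2-cancelˡ : ∀ r a → (r + a) % 2 ≡ r % 2 → 2 ∣ a
    %2-cancelˡ zero          a            eq = m%n≡0⇒n∣m a 2 eq
    %2-cancelˡ (suc zero)    zero         eq = 2 ∣0
    %2-cancelˡ (suc zero)    (suc zero)   ()
    %2-cancelˡ (suc zero)    (suc (suc a)) eq with %2-cancelˡ (suc zero) a eq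
    ... | divides q a≡q*2 = divides (suc q) (cong (λ x → suc (suc x)) a≡q*2)
    %2-cancelˡ (suc (suc r)) a            eq = %2-cancelˡ r a eq

    -- a^r b and a^s b are conjugate under a^d for d = (s - r) / 2 taken modulo 2n.
    conjugatingExponent : ∀ r s → r < M → s < M → r % 2 ≡ s % 2 → ∃ λ d → d < M × (r + d + d) Mod-M.≈ s
    conjugatingExponent r s r<M s<M r≡s with r ≤? s
    ... | yes r≤s = d , d<M , cong (_% M) r+2d≡s
      where
      a = s ∸ r
      2∣a : 2 ∣ a
      2∣a = %2-cancelˡ r a (trans (cong (_% 2) (m+[n∸m]≡n r≤s)) (sym r≡s))
      d = a / 2
      r+2d≡s : r + d + d ≡ s
      r+2d≡s = trans (ring r d) (trans (cong (_+_ r) (m*[n/m]≡n 2∣a)) (m+[n∸m]≡n r≤s))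
        where ring : ∀ r d → r + d + d ≡ r + 2 * d
              ring = solve-∀
      d<M : d < M
      d<M = ≤-<-trans (m/n≤m a 2) (≤-<-trans (m∸n≤m s r) s<M)
    ... | no r≰s = d , d<M , trans (cong (_% M) r+2d≡s+M) ([m+n]%n≡m%n s M)
      where
      r≤s+M : r ≤ s + M
      r≤s+M = ≤-trans (<⇒≤ r<M) (m≤n+m M s)
      a = (s + M) ∸ r
      2∣a : 2 ∣ a
      2∣a = %2-cancelˡ r a (trans (cong (_% 2) (m+[n∸m]≡n r≤s+M)) (trans (%-remove-+ʳ s 2∣M) (sym r≡s)))
      d = a / 2
      r+2d≡s+M : r + d + d ≡ s + M
      r+2d≡s+M = trans (ring r d) (trans (cong (_+_ r) (m*[n/m]≡n 2∣a)) (m+[n∸m]≡n r≤s+M))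
        where ring : ∀ r d → r + d + d ≡ r + 2 * d
              ring = solve-∀
      d<M : d < M
      d<M = ≤-<-trans (m/n≤m a 2) (m<n+o⇒m∸n<o (s + M) r (+-monoˡ-< M (≰⇒> r≰s)))

    central-cases : ∀ s → n ∣ s → s < M → s ≡ 0 ⊎ s ≡ n
    central-cases s (divides zero          s≡0)   _   = inj₁ s≡0
    central-cases s (divides (suc zero)    s≡n)   _   = inj₂ (trans s≡n (+-identityʳ n))
    central-cases s (divides (suc (suc q)) s≡q*n) s<M = ⊥-elim (<⇒≱ s<M (subst (M ≤_) (sym s≡q*n)
      (subst (_≤ suc (suc q) * n) (ring n) (+-monoʳ-≤ n (+-monoʳ-≤ n z≤n)))))
      where ring : ∀ n → n + (n + 0) ≡ 2 * n
            ring = solve-∀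

    rotationClass-central : ∀ {s} → rotationClass s ≡ central → n ∣ s
    rotationClass-central {s} eq with n ∣? s
    ... | yes n∣s = n∣s
    rotationClass-central () | no _

    reflectionClass-cases : ∀ r → reflectionClass r ≡ reflection₀ ⊎ reflectionClass r ≡ reflection₁
    reflectionClass-cases r with 2 ∣? r
    ... | yes _ = inj₁ refl
    ... | no  _ = inj₂ refl

    starAdj-reflection-rotation : ∀ r s → starAdj (reflectionClass r) (rotationClass s) ≡ + 1 → n ∣ s
    starAdj-reflection-rotation r s adj with reflectionClass-cases r | rotationClass-cases s
    ... | _       | inj₁ s-central = rotationClass-central s-central
    ... | inj₁ r₀ | inj₂ s-rot rewrite r₀ | s-rot with adj
    ... | ()
    starAdj-reflection-rotation r s adj | inj₂ r₁ | inj₂ s-rot rewrite r₁ | s-rot with adj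
    ... | ()

    starAdj-rotation-reflection : ∀ r s → starAdj (rotationClass r) (reflectionClass s) ≡ + 1 → n ∣ r
    starAdj-rotation-reflection r s adj with rotationClass-cases r | reflectionClass-cases s
    ... | inj₁ r-central | _ = rotationClass-central r-central
    ... | inj₂ r-rot | inj₁ s₀ rewrite r-rot | s₀ with adj
    ... | ()
    starAdj-rotation-reflection r s adj | inj₂ r-rot | inj₂ s₁ rewrite r-rot | s₁ with adj
    ... | ()

    starAdj-reflections : ∀ r s → starAdj (reflectionClass r) (reflectionClass s) ≡ + 1 → r % 2 ≡ s % 2
    starAdj-reflections r s adj with 2 ∣? r | 2 ∣? s
    ... | yes 2∣r | yes 2∣s = trans (n∣m⇒m%n≡0 r 2 2∣r) (sym (n∣m⇒m%n≡0 s 2 2∣s))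
    ... | no  2∤r | no  2∤s = trans (odd r 2∤r) (sym (odd s 2∤s))
      where
      odd : ∀ x → ¬ 2 ∣ x → x % 2 ≡ 1
      odd x 2∤x with x % 2 in eq | m%n<n x 2
      ... | 0           | _ = ⊥-elim (2∤x (m%n≡0⇒n∣m x 2 eq))
      ... | 1           | _ = refl
      ... | suc (suc _) | s≤s (s≤s ())
    ... | yes _ | no _ with adj
    ... | ()
    starAdj-reflections r s adj | no _ | yes _ with adj
    ... | ()

    Witness : Fin (N n) → Fin (N n) → Set
    Witness i j = ∃[ g ] ∃[ h ] ∃[ z ] ∃[ p ] ∃[ q ]
      (conj n (elt n g) (elt n i) ≡ pow n (elt n z) p × conj n (elt n h) (elt n j) ≡ pow n (elt n z) q)

    eIndex : Fin (N n)
    eIndex = rotationIndex 0 (>-nonZero⁻¹ M)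

    conj-eIndex : ∀ k → conj n (elt n eIndex) (elt n k) ≡ elt n k
    conj-eIndex k = trans (cong (λ w → conj n w (elt n k)) (elt-rotationIndex 0 (>-nonZero⁻¹ M))) (conj-e (elt n k) (elt-bounded k))

    cyclicWitness : ∀ {i j} z p q → elt n i ≡ pow n (elt n z) p → elt n j ≡ pow n (elt n z) q → Witness i j
    cyclicWitness {i} {j} z p q xᵢ≡zᵖ xⱼ≡zᑫ =
      eIndex , eIndex , z , p , q , trans (conj-eIndex i) xᵢ≡zᵖ , trans (conj-eIndex j) xⱼ≡zᑫ

    witness : ∀ i j x y → elt n i ≡ x → elt n j ≡ y → proj₁ x < M → proj₁ y < M →
      starAdj (classOf x) (classOf y) ≡ + 1 → Witness i j
    witness i j (r , false) (s , false) xᵢ≡ xⱼ≡ r<M s<M _ =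
      cyclicWitness (rotationIndex 1 1<M) r s (trans xᵢ≡ (sym (a-power r r<M))) (trans xⱼ≡ (sym (a-power s s<M)))
      where
      1<M : 1 < M
      1<M = ≤-<-trans (>-nonZero⁻¹ n) n<M
      a-power : ∀ p → p < M → pow n (elt n (rotationIndex 1 1<M)) p ≡ (p , false)
      a-power p p<M = trans (cong (λ w → pow n w p) (elt-rotationIndex 1 1<M)) (pow-a p p<M)
    witness i j (r , true) (s , false) xᵢ≡ xⱼ≡ r<M s<M adj
      with central-cases s (starAdj-reflection-rotation r s adj) s<M
    ... | inj₁ refl = cyclicWitness i 1 0 (trans xᵢ≡ (sym (trans (cong (λ w → pow n w 1) xᵢ≡) (pow-b¹ r r<M)))) xⱼ≡
    ... | inj₂ refl = cyclicWitness i 1 2 (trans xᵢ≡ (sym (trans (cong (λ w → pow n w 1) xᵢ≡) (pow-b¹ r r<M))))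
                                          (trans xⱼ≡ (sym (trans (cong (λ w → pow n w 2) xᵢ≡) (pow-b² r r<M))))
    witness i j (r , false) (s , true) xᵢ≡ xⱼ≡ r<M s<M adj
      with central-cases r (starAdj-rotation-reflection r s adj) r<M
    ... | inj₁ refl = cyclicWitness j 0 1 xᵢ≡ (trans xⱼ≡ (sym (trans (cong (λ w → pow n w 1) xⱼ≡) (pow-b¹ s s<M))))
    ... | inj₂ refl = cyclicWitness j 2 1 (trans xᵢ≡ (sym (trans (cong (λ w → pow n w 2) xⱼ≡) (pow-b² s s<M))))
                                          (trans xⱼ≡ (sym (trans (cong (λ w → pow n w 1) xⱼ≡) (pow-b¹ s s<M))))
    witness i j (r , true) (s , true) xᵢ≡ xⱼ≡ r<M s<M adj
      with conjugatingExponent r s r<M s<M (starAdj-reflections r s adj)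
    ... | d , d<M , r+2d≈s = rotationIndex d d<M , eIndex , j , 1 , 1 ,
      trans (cong₂ (conj n) (elt-rotationIndex d d<M) xᵢ≡) (trans (conj-a-b d r s d<M s<M r+2d≈s) (sym xⱼ¹)) ,
      trans (conj-eIndex j) (trans xⱼ≡ (sym xⱼ¹))
      where
      xⱼ¹ : pow n (elt n j) 1 ≡ (s , true)
      xⱼ¹ = trans (cong (λ w → pow n w 1) xⱼ≡) (pow-b¹ s s<M)

    starAdj⇒Adj : ∀ i j → i ≢ j → starAdj (vertexClass i) (vertexClass j) ≡ + 1 → Adj n i j
    starAdj⇒Adj i j i≢j adj = i≢j , witness i j (elt n i) (elt n j) refl refl (elt-bounded i) (elt-bounded j) adj

  occurrencesFrom : (ℕ → Class) → ℕ → ℕ → Class → ℕ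
  occurrencesFrom f s zero    c = 0
  occurrencesFrom f s (suc k) c = indicator (f s) c + occurrencesFrom f (suc s) k c

  occurrences≡occurrencesFrom : ∀ k (t : Fin k → Class) f s → (∀ i → t i ≡ f (s + toℕ i)) →
    ∀ c → occurrences t c ≡ occurrencesFrom f s k c
  occurrences≡occurrencesFrom zero    t f s t≗f c = refl
  occurrences≡occurrencesFrom (suc k) t f s t≗f c =
    cong₂ _+_ (cong (λ a → indicator a c) (trans (t≗f zero) (cong f (+-identityʳ s))))
              (occurrences≡occurrencesFrom k (tail t) f (suc s) (λ i → trans (t≗f (suc i)) (cong f (+-suc s (toℕ i)))) c)

  occurrencesFrom-+ : ∀ f s a b c → occurrencesFrom f s (a + b) c ≡ occurrencesFrom f s a c + occurrencesFrom f (s + a) b c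
  occurrencesFrom-+ f s zero    b c = cong (λ s′ → occurrencesFrom f s′ b c) (sym (+-identityʳ s))
  occurrencesFrom-+ f s (suc a) b c = begin
    indicator (f s) c + occurrencesFrom f (suc s) (a + b) c
      ≡⟨ cong (_+_ (indicator (f s) c)) (occurrencesFrom-+ f (suc s) a b c) ⟩
    indicator (f s) c + (occurrencesFrom f (suc s) a c + occurrencesFrom f (suc s + a) b c)
      ≡⟨ cong (λ s′ → indicator (f s) c + (occurrencesFrom f (suc s) a c + occurrencesFrom f s′ b c)) (sym (+-suc s a)) ⟩
    indicator (f s) c + (occurrencesFrom f (suc s) a c + occurrencesFrom f (s + suc a) b c)
      ≡⟨ +-assoc (indicator (f s) c) _ _ ⟨
    indicator (f s) c + occurrencesFrom f (suc s) a c + occurrencesFrom f (s + suc a) b c ∎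
    where open ≡-Reasoning

  occurrencesFrom-cong : ∀ f g s k c → (∀ i → i < k → f (s + i) ≡ g (s + i)) → occurrencesFrom f s k c ≡ occurrencesFrom g s k c
  occurrencesFrom-cong f g s zero    c f≗g = refl
  occurrencesFrom-cong f g s (suc k) c f≗g =
    cong₂ _+_ (cong (λ a → indicator a c) (trans (cong f (sym (+-identityʳ s))) (trans (f≗g 0 z<s) (cong g (+-identityʳ s)))))
              (occurrencesFrom-cong f g (suc s) k c
                (λ i i<k → trans (cong f (sym (+-suc s i))) (trans (f≗g (suc i) (s<s i<k)) (cong g (+-suc s i)))))

  occurrencesFrom-const : ∀ f s k c d → (∀ i → i < k → f (s + i) ≡ d) → occurrencesFrom f s k c ≡ k * indicator d c
  occurrencesFrom-const f s zero    c d f≡d = refl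
  occurrencesFrom-const f s (suc k) c d f≡d =
    cong₂ _+_ (cong (λ a → indicator a c) (trans (cong f (sym (+-identityʳ s))) (f≡d 0 z<s)))
              (occurrencesFrom-const f (suc s) k c d (λ i i<k → trans (cong f (sym (+-suc s i))) (f≡d (suc i) (s<s i<k))))

  occurrencesFrom-alternating : ∀ f m s c d d′ → (∀ i → f (s + 2 * i) ≡ d) → (∀ i → f (s + suc (2 * i)) ≡ d′) →
    occurrencesFrom f s (2 * m) c ≡ m * (indicator d c + indicator d′ c)
  occurrencesFrom-alternating f zero    s c d d′ even odd = refl
  occurrencesFrom-alternating f (suc m) s c d d′ even odd = begin
    occurrencesFrom f s (2 * suc m) c
      ≡⟨ cong (λ k → occurrencesFrom f s k c) (ring₁ m) ⟩
    indicator (f s) c + (indicator (f (suc s)) c + occurrencesFrom f (suc (suc s)) (2 * m) c)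
      ≡⟨ cong₂ (λ a b → indicator a c + (indicator b c + occurrencesFrom f (suc (suc s)) (2 * m) c))
               (trans (cong f (sym (+-identityʳ s))) (even 0))
               (trans (cong f (sym (trans (+-suc s 0) (cong suc (+-identityʳ s))))) (odd 0)) ⟩
    indicator d c + (indicator d′ c + occurrencesFrom f (suc (suc s)) (2 * m) c)
      ≡⟨ cong (λ z → indicator d c + (indicator d′ c + z))
              (occurrencesFrom-alternating f m (suc (suc s)) c d d′
                (λ i → trans (cong f (ring₂ s i)) (even (suc i))) (λ i → trans (cong f (ring₃ s i)) (odd (suc i)))) ⟩
    indicator d c + (indicator d′ c + m * (indicator d c + indicator d′ c))
      ≡⟨ ring₄ (indicator d c) (indicator d′ c) m ⟩
    suc m * (indicator d c + indicator d′ c) ∎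
    where
    open ≡-Reasoning
    ring₁ : ∀ m → 2 * suc m ≡ suc (suc (2 * m))
    ring₁ = solve-∀
    ring₂ : ∀ s i → suc (suc s) + 2 * i ≡ s + 2 * suc i
    ring₂ = solve-∀
    ring₃ : ∀ s i → suc (suc s) + suc (2 * i) ≡ s + suc (2 * suc i)
    ring₃ = solve-∀
    ring₄ : ∀ a b m → a + (b + m * (a + b)) ≡ suc m * (a + b)
    ring₄ = solve-∀

  -- The class sizes of Q_4n for n = n′ + 1.
  classSize : ℕ → Class → ℕ
  classSize n′ central     = 2
  classSize n′ rotation    = n′ + n′
  classSize n′ reflection₀ = suc n′
  classSize n′ reflection₁ = suc n′

  module ClassSizes (n′ : ℕ) (n-even : 2 ∣ suc n′) where

    n : ℕ
    n = suc n′

    open Dicyclic n n-even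

    classAt : ℕ → Class
    classAt k = classOf (if k <ᵇ M then (k , false) else (k ∸ M , true))

    classAt-rotation : ∀ k → k < M → classAt k ≡ rotationClass k
    classAt-rotation k k<M with k <ᵇ M in eq
    ... | true  = refl
    ... | false = ⊥-elim (subst T eq (<⇒<ᵇ k<M))

    classAt-reflection : ∀ i → classAt (M + i) ≡ reflectionClass i
    classAt-reflection i with M + i <ᵇ M in eq
    ... | true  = ⊥-elim (<⇒≱ (<ᵇ⇒< (M + i) M (subst T (sym eq) _)) (m≤m+n M i))
    ... | false = cong reflectionClass (m+n∸m≡n M i)

    rotationClass-rotation : ∀ k → 0 < k → k < n → rotationClass k ≡ rotation
    rotationClass-rotation k 0<k k<n = Mod-n.byDivisibility-∤ (λ n∣k → <⇒≱ k<n (∣⇒≤ {{>-nonZero 0<k}} n∣k))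

    occurrences-rotations : ∀ c → occurrencesFrom rotationClass 0 M c ≡ 2 * (indicator central c + n′ * indicator rotation c)
    occurrences-rotations c = begin
      occurrencesFrom rotationClass 0 M c
        ≡⟨ cong (λ k → occurrencesFrom rotationClass 0 k c) (cong (_+_ n) (+-identityʳ n)) ⟩
      occurrencesFrom rotationClass 0 (n + n) c
        ≡⟨ occurrencesFrom-+ rotationClass 0 n n c ⟩
      occurrencesFrom rotationClass 0 n c + occurrencesFrom rotationClass n n c
        ≡⟨ cong₂ _+_ (half 0 (n ∣0) (λ i i<n′ → rotationClass-rotation (suc i) z<s (s<s i<n′)))
                     (half n ∣-refl (λ i i<n′ → rotationClass-rotation′ i i<n′)) ⟩
      (indicator central c + n′ * indicator rotation c) + (indicator central c + n′ * indicator rotation c)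
        ≡⟨ cong (_+_ (indicator central c + n′ * indicator rotation c)) (+-identityʳ _) ⟨
      2 * (indicator central c + n′ * indicator rotation c) ∎
      where
      open ≡-Reasoning
      half : ∀ s → n ∣ s → (∀ i → i < n′ → rotationClass (suc s + i) ≡ rotation) →
        occurrencesFrom rotationClass s n c ≡ indicator central c + n′ * indicator rotation c
      half s n∣s others = cong₂ _+_ (cong (λ a → indicator a c) (Mod-n.byDivisibility-∣ n∣s))
                                    (occurrencesFrom-const rotationClass (suc s) n′ c rotation others)
      rotationClass-rotation′ : ∀ i → i < n′ → rotationClass (suc n + i) ≡ rotation
      rotationClass-rotation′ i i<n′ = Mod-n.byDivisibility-∤ λ n∣n+1+i →
        <⇒≱ (s<s i<n′) (∣⇒≤ (∣m+n∣m⇒∣n (subst (n ∣_) (sym (+-suc n i)) n∣n+1+i) ∣-refl))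

    occurrences-reflections : ∀ c → occurrencesFrom classAt M M c ≡ n * (indicator reflection₀ c + indicator reflection₁ c)
    occurrences-reflections c = occurrencesFrom-alternating classAt n M c reflection₀ reflection₁
      (λ i → trans (classAt-reflection (2 * i)) (Mod-2.byDivisibility-∣ (divides i (*-comm 2 i))))
      (λ i → trans (classAt-reflection (suc (2 * i))) (Mod-2.byDivisibility-∤ (odd i)))
      where
      odd : ∀ i → ¬ 2 ∣ suc (2 * i)
      odd i 2∣1+2i with ∣1⇒≡1 (∣m+n∣m⇒∣n (subst (2 ∣_) (+-comm 1 (2 * i)) 2∣1+2i) (divides i (*-comm 2 i)))
      ... | ()

    occurrences-vertexClass : ∀ c → occurrences vertexClass c ≡ classSize n′ c
    occurrences-vertexClass c = begin
      occurrences vertexClass c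
        ≡⟨ occurrences≡occurrencesFrom (N n) vertexClass classAt 0 (λ _ → refl) c ⟩
      occurrencesFrom classAt 0 (4 * n) c
        ≡⟨ cong (λ k → occurrencesFrom classAt 0 k c) (ring n) ⟩
      occurrencesFrom classAt 0 (M + M) c
        ≡⟨ occurrencesFrom-+ classAt 0 M M c ⟩
      occurrencesFrom classAt 0 M c + occurrencesFrom classAt M M c
        ≡⟨ cong (_+ occurrencesFrom classAt M M c) (occurrencesFrom-cong classAt rotationClass 0 M c classAt-rotation) ⟩
      occurrencesFrom rotationClass 0 M c + occurrencesFrom classAt M M c
        ≡⟨ cong₂ _+_ (occurrences-rotations c) (occurrences-reflections c) ⟩
      2 * (indicator central c + n′ * indicator rotation c) + n * (indicator reflection₀ c + indicator reflection₁ c)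
        ≡⟨ sizes c ⟩
      classSize n′ c ∎
      where
      open ≡-Reasoning
      ring : ∀ n → 4 * n ≡ 2 * n + 2 * n
      ring = solve-∀
      sizes : ∀ c → 2 * (indicator central c + n′ * indicator rotation c) + n * (indicator reflection₀ c + indicator reflection₁ c)
                    ≡ classSize n′ c
      sizes central     = sizeCentral n′
        where sizeCentral : ∀ m → 2 * (1 + m * 0) + suc m * (0 + 0) ≡ 2
              sizeCentral = solve-∀
      sizes rotation    = sizeRotation n′
        where sizeRotation : ∀ m → 2 * (0 + m * 1) + suc m * (0 + 0) ≡ m + m
              sizeRotation = solve-∀
      sizes reflection₀ = sizeReflection₀ n′
        where sizeReflection₀ : ∀ m → 2 * (0 + m * 0) + suc m * (1 + 0) ≡ suc m
              sizeReflection₀ = solve-∀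
      sizes reflection₁ = sizeReflection₁ n′
        where sizeReflection₁ : ∀ m → 2 * (0 + m * 0) + suc m * (0 + 1) ≡ suc m
              sizeReflection₁ = solve-∀

open DicyclicGroup

open import Data.Integer using (-_; _+_; _*_; _-_; _^_)
import Data.Integer.Properties as ℤP
open import Data.Integer.Tactic.RingSolver using (solve-∀)
import Data.Nat.Tactic.RingSolver as ℕ-Solver
open import Algebra.Properties.CommutativeSemigroup ℕP.+-commutativeSemigroup using (x∙yz≈y∙xz)

Σ-cong : ∀ k {f g : Fin k → ℤ} → (∀ j → f j ≡ g j) → Σ k f ≡ Σ k g
Σ-cong zero    f≗g = refl
Σ-cong (suc k) f≗g = cong₂ _+_ (f≗g zero) (Σ-cong k (f≗g ∘ suc))

Σ-zero : ∀ k → Σ k (λ _ → + 0) ≡ + 0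
Σ-zero zero    = refl
Σ-zero (suc k) = trans (ℤP.+-identityˡ _) (Σ-zero k)

Σ-+ : ∀ k (f g : Fin k → ℤ) → Σ k (λ j → f j + g j) ≡ Σ k f + Σ k g
Σ-+ zero    f g = refl
Σ-+ (suc k) f g = begin
  f zero + g zero + Σ k (λ j → f (suc j) + g (suc j))
    ≡⟨ cong (_+_ (f zero + g zero)) (Σ-+ k (f ∘ suc) (g ∘ suc)) ⟩
  f zero + g zero + (Σ k (f ∘ suc) + Σ k (g ∘ suc))
    ≡⟨ interchange (f zero) (g zero) (Σ k (f ∘ suc)) (Σ k (g ∘ suc)) ⟩
  f zero + Σ k (f ∘ suc) + (g zero + Σ k (g ∘ suc)) ∎
  where
  open ≡-Reasoning
  interchange : ∀ a b c d → a + b + (c + d) ≡ a + c + (b + d)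
  interchange = solve-∀

Σ-*ˡ : ∀ k (c : ℤ) (f : Fin k → ℤ) → Σ k (λ j → c * f j) ≡ c * Σ k f
Σ-*ˡ zero    c f = sym (ℤP.*-zeroʳ c)
Σ-*ˡ (suc k) c f = trans (cong (_+_ (c * f zero)) (Σ-*ˡ k c (f ∘ suc)))
                         (sym (ℤP.*-distribˡ-+ c (f zero) (Σ k (f ∘ suc))))

Σ-neg : ∀ k (f : Fin k → ℤ) → Σ k (λ j → - f j) ≡ - Σ k f
Σ-neg zero    f = refl
Σ-neg (suc k) f = trans (cong (_+_ (- f zero)) (Σ-neg k (f ∘ suc)))
                        (sym (ℤP.neg-distrib-+ (f zero) (Σ k (f ∘ suc))))

Σ-difference : ∀ k (f g : Fin k → ℤ) → Σ k (λ j → f j - g j) ≡ Σ k f - Σ k g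
Σ-difference k f g = trans (Σ-+ k f (λ j → - g j)) (cong (_+_ (Σ k f)) (Σ-neg k g))

Σ-extract : ∀ k (f : Fin (suc k) → ℤ) (j : Fin (suc k)) → Σ (suc k) f ≡ f j + Σ k (f ∘ punchIn j)
Σ-extract k       f zero    = refl
Σ-extract (suc k) f (suc j) = begin
  f zero + Σ (suc k) (f ∘ suc)
    ≡⟨ cong (_+_ (f zero)) (Σ-extract k (f ∘ suc) j) ⟩
  f zero + (f (suc j) + Σ k (f ∘ suc ∘ punchIn j))
    ≡⟨ left-comm (f zero) (f (suc j)) _ ⟩
  f (suc j) + (f zero + Σ k (f ∘ suc ∘ punchIn j)) ∎
  where
  open ≡-Reasoning
  left-comm : ∀ a b c → a + (b + c) ≡ b + (a + c)
  left-comm = solve-∀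

Σ-comm : ∀ m n (h : Fin m → Fin n → ℤ) → Σ m (λ i → Σ n (h i)) ≡ Σ n (λ j → Σ m (λ i → h i j))
Σ-comm zero    n h = sym (Σ-zero n)
Σ-comm (suc m) n h = trans (cong (_+_ (Σ n (h zero))) (Σ-comm m n (h ∘ suc)))
                           (sym (Σ-+ n (h zero) (λ j → Σ m (λ i → h (suc i) j))))

Σ-sift : ∀ k (i : Fin k) (f : Fin k → ℤ) → Σ k (λ j → δ i j * f j) ≡ f i
Σ-sift (suc k) i f = begin
  Σ (suc k) (λ j → δ i j * f j)
    ≡⟨ Σ-extract k (λ j → δ i j * f j) i ⟩
  δ i i * f i + Σ k (λ l → δ i (punchIn i l) * f (punchIn i l))
    ≡⟨ cong₂ _+_ (cong (_* f i) (δ-refl i)) (Σ-cong k (λ l → cong (_* f (punchIn i l)) (δ-≢ (punchInᵢ≢i i l ∘ sym)))) ⟩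
  + 1 * f i + Σ k (λ l → + 0 * f (punchIn i l))
    ≡⟨ cong₂ _+_ (ℤP.*-identityˡ (f i)) (Σ-zero k) ⟩
  f i + + 0
    ≡⟨ ℤP.+-identityʳ (f i) ⟩
  f i ∎
  where open ≡-Reasoning

sign-suc : ∀ k → sign (suc k) ≡ - sign k
sign-suc zero          = refl
sign-suc (suc zero)    = refl
sign-suc (suc (suc k)) = sign-suc k

sg : ∀ {k} → Fin k → ℤ
sg j = sign (toℕ j)

det-cong : ∀ k {M N : Matrix k} → (∀ i j → M i j ≡ N i j) → det k M ≡ det k N
det-cong zero    M≗N = refl
det-cong (suc k) M≗N = Σ-cong (suc k) λ j →
  cong₂ _*_ (cong (sg j *_) (M≗N zero j)) (det-cong k (λ r c → M≗N (suc r) (punchIn j c)))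

det-expandColumn₀ : ∀ k (M : Matrix (suc k)) →
  det (suc k) M ≡ Σ (suc k) (λ i → sg i * M i zero * det k (λ r c → M (punchIn i r) (suc c)))
det-expandColumn₀ zero    M = refl
det-expandColumn₀ (suc k) M = cong (_+_ (+ 1 * M zero zero * det (suc k) (λ r c → M (suc r) (suc c)))) expansions
  where
  open ≡-Reasoning
  W : Fin (suc k) → Fin (suc k) → ℤ
  W i j = det k (λ r c → M (suc (punchIn i r)) (suc (punchIn j c)))
  X Y : Fin (suc k) → ℤ
  X j = M zero (suc j)
  Y i = M (suc i) zero
  reorder : ∀ i j → sg (suc j) * X j * (sg i * Y i * W i j) ≡ sg (suc i) * Y i * (sg j * X j * W i j)
  reorder i j rewrite sign-suc (toℕ i) | sign-suc (toℕ j) = ring (sg i) (sg j) (X j) (Y i) (W i j)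
    where
    ring : ∀ a b x y w → - b * x * (a * y * w) ≡ - a * y * (b * x * w)
    ring = solve-∀
  expansions : Σ (suc k) (λ j → sg (suc j) * X j * det (suc k) (λ r c → M (suc r) (punchIn (suc j) c)))
             ≡ Σ (suc k) (λ i → sg (suc i) * Y i * det (suc k) (λ r c → M (punchIn (suc i) r) (suc c)))
  expansions = begin
    Σ (suc k) (λ j → sg (suc j) * X j * det (suc k) (λ r c → M (suc r) (punchIn (suc j) c)))
      ≡⟨ Σ-cong (suc k) (λ j → cong (sg (suc j) * X j *_) (det-expandColumn₀ k (λ r c → M (suc r) (punchIn (suc j) c)))) ⟩
    Σ (suc k) (λ j → sg (suc j) * X j * Σ (suc k) (λ i → sg i * Y i * W i j))
      ≡⟨ Σ-cong (suc k) (λ j → sym (Σ-*ˡ (suc k) (sg (suc j) * X j) (λ i → sg i * Y i * W i j))) ⟩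
    Σ (suc k) (λ j → Σ (suc k) (λ i → sg (suc j) * X j * (sg i * Y i * W i j)))
      ≡⟨ Σ-cong (suc k) (λ j → Σ-cong (suc k) (λ i → reorder i j)) ⟩
    Σ (suc k) (λ j → Σ (suc k) (λ i → sg (suc i) * Y i * (sg j * X j * W i j)))
      ≡⟨ Σ-comm (suc k) (suc k) (λ j i → sg (suc i) * Y i * (sg j * X j * W i j)) ⟩
    Σ (suc k) (λ i → Σ (suc k) (λ j → sg (suc i) * Y i * (sg j * X j * W i j)))
      ≡⟨ Σ-cong (suc k) (λ i → Σ-*ˡ (suc k) (sg (suc i) * Y i) (λ j → sg j * X j * W i j)) ⟩
    Σ (suc k) (λ i → sg (suc i) * Y i * Σ (suc k) (λ j → sg j * X j * W i j)) ∎

det-transpose : ∀ k (M : Matrix k) → det k (λ i j → M j i) ≡ det k M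
det-transpose zero    M = refl
det-transpose (suc k) M = trans
  (Σ-cong (suc k) (λ j → cong (sg j * M j zero *_) (det-transpose k (λ r c → M (punchIn j r) (suc c)))))
  (sym (det-expandColumn₀ k M))

punchIn-punchOut-comm : ∀ {k} (a b : Fin (suc (suc k))) (a≢b : a ≢ b) (b≢a : b ≢ a) (c : Fin k) →
  punchIn a (punchIn (punchOut a≢b) c) ≡ punchIn b (punchIn (punchOut b≢a) c)
punchIn-punchOut-comm zero    zero    a≢b _ c = ⊥-elim (a≢b refl)
punchIn-punchOut-comm zero    (suc b) _   _ c = refl
punchIn-punchOut-comm (suc a) zero    _   _ c = refl
punchIn-punchOut-comm {zero}  (suc zero) (suc zero) a≢b _ c = ⊥-elim (a≢b refl)
punchIn-punchOut-comm {suc k} (suc a) (suc b) _ _ zero = refl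
punchIn-punchOut-comm {suc k} (suc a) (suc b) a≢b b≢a (suc c) =
  cong suc (punchIn-punchOut-comm a b (a≢b ∘ cong suc) (b≢a ∘ cong suc) c)

sign-punchOut-anticomm : ∀ {k} (a b : Fin (suc (suc k))) (a≢b : a ≢ b) (b≢a : b ≢ a) →
  sg a * sg (punchOut a≢b) ≡ - (sg b * sg (punchOut b≢a))
sign-punchOut-anticomm zero zero a≢b _ = ⊥-elim (a≢b refl)
sign-punchOut-anticomm zero (suc b) _ _ rewrite sign-suc (toℕ b) = ring (sg b)
  where ring : ∀ x → + 1 * x ≡ - (- x * + 1)
        ring = solve-∀
sign-punchOut-anticomm (suc a) zero _ _ rewrite sign-suc (toℕ a) = ring (sg a)
  where ring : ∀ x → - x * + 1 ≡ - (+ 1 * x)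
        ring = solve-∀
sign-punchOut-anticomm {zero} (suc zero) (suc zero) a≢b _ = ⊥-elim (a≢b refl)
sign-punchOut-anticomm {suc k} (suc a) (suc b) a≢b b≢a
  rewrite sign-suc (toℕ a) | sign-suc (toℕ b)
        | sign-suc (toℕ (punchOut (a≢b ∘ cong suc))) | sign-suc (toℕ (punchOut (b≢a ∘ cong suc))) =
  trans (ring (sg a) (sg (punchOut (a≢b ∘ cong suc))))
    (trans (sign-punchOut-anticomm a b (a≢b ∘ cong suc) (b≢a ∘ cong suc))
      (cong -_ (sym (ring (sg b) (sg (punchOut (b≢a ∘ cong suc)))))))
  where ring : ∀ x y → - x * - y ≡ x * y
        ring = solve-∀

stack : ∀ {k} (X Y : Fin (suc (suc k)) → ℤ) → (Fin k → Fin (suc (suc k)) → ℤ) → Matrix (suc (suc k))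
stack X Y B zero          = X
stack X Y B (suc zero)    = Y
stack X Y B (suc (suc r)) = B r

-- Expanding along the first two rows writes det (stack X Y B) as a double sum over the
-- pairs of distinct columns (a , b) read in X and Y; exchanging X and Y negates each term.
det-stack-swap : ∀ {k} (X Y : Fin (suc (suc k)) → ℤ) (B : Fin k → Fin (suc (suc k)) → ℤ) →
  det (suc (suc k)) (stack Y X B) ≡ - det (suc (suc k)) (stack X Y B)
det-stack-swap {k} X Y B = begin
  det n (stack Y X B)                       ≡⟨ det-pairs Y X ⟩
  Σ n (λ a → Σ n (λ b → term Y X a b))       ≡⟨ Σ-cong n (λ a → Σ-cong n (λ b → term-anti a b)) ⟩
  Σ n (λ a → Σ n (λ b → - term X Y b a))     ≡⟨ Σ-cong n (λ a → Σ-neg n (λ b → term X Y b a)) ⟩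
  Σ n (λ a → - Σ n (λ b → term X Y b a))     ≡⟨ Σ-neg n (λ a → Σ n (λ b → term X Y b a)) ⟩
  - Σ n (λ a → Σ n (λ b → term X Y b a))     ≡⟨ cong -_ (Σ-comm n n (λ a b → term X Y b a)) ⟩
  - Σ n (λ b → Σ n (λ a → term X Y b a))     ≡⟨ cong -_ (det-pairs X Y) ⟨
  - det n (stack X Y B)                     ∎
  where
  open ≡-Reasoning
  n = suc (suc k)
  minor : (Fin k → Fin n) → ℤ
  minor f = det k (λ r c → B r (f c))
  term : (X Y : Fin n → ℤ) → Fin n → Fin n → ℤ
  term X Y a b with a ≟ b
  ... | yes _   = + 0
  ... | no  a≢b = sg a * X a * (sg (punchOut a≢b) * Y b * minor (punchIn a ∘ punchIn (punchOut a≢b)))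
  term-punchIn : ∀ X Y a l →
    term X Y a (punchIn a l) ≡ sg a * X a * (sg l * Y (punchIn a l) * minor (punchIn a ∘ punchIn l))
  term-punchIn X Y a l with a ≟ punchIn a l
  ... | yes a≡ = ⊥-elim (punchInᵢ≢i a l (sym a≡))
  ... | no a≢ rewrite trans (punchOut-cong a {i≢j = a≢} {i≢k = punchInᵢ≢i a l ∘ sym} refl) (punchOut-punchIn a {l}) = refl
  term-diag : ∀ X Y a → term X Y a a ≡ + 0
  term-diag X Y a with a ≟ a
  ... | yes _   = refl
  ... | no  a≢a = ⊥-elim (a≢a refl)
  det-pairs : ∀ X Y → det n (stack X Y B) ≡ Σ n (λ a → Σ n (term X Y a))
  det-pairs X Y = Σ-cong n λ a → begin
    sg a * X a * det (suc k) (λ r c → stack X Y B (suc r) (punchIn a c))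
      ≡⟨ Σ-*ˡ (suc k) (sg a * X a) (λ l → sg l * Y (punchIn a l) * minor (punchIn a ∘ punchIn l)) ⟨
    Σ (suc k) (λ l → sg a * X a * (sg l * Y (punchIn a l) * minor (punchIn a ∘ punchIn l)))
      ≡⟨ Σ-cong (suc k) (term-punchIn X Y a) ⟨
    Σ (suc k) (term X Y a ∘ punchIn a)
      ≡⟨ ℤP.+-identityˡ _ ⟨
    + 0 + Σ (suc k) (term X Y a ∘ punchIn a)
      ≡⟨ cong (_+ Σ (suc k) (term X Y a ∘ punchIn a)) (term-diag X Y a) ⟨
    term X Y a a + Σ (suc k) (term X Y a ∘ punchIn a)
      ≡⟨ Σ-extract (suc k) (term X Y a) a ⟨
    Σ n (term X Y a) ∎
  term-anti : ∀ a b → term Y X a b ≡ - term X Y b a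
  term-anti a b with a ≟ b | b ≟ a
  ... | yes _    | yes _   = refl
  ... | yes a≡b  | no b≢a  = ⊥-elim (b≢a (sym a≡b))
  ... | no a≢b   | yes b≡a = ⊥-elim (a≢b (sym b≡a))
  ... | no a≢b   | no b≢a  = begin
    sg a * Y a * (sg (punchOut a≢b) * X b * minor (punchIn a ∘ punchIn (punchOut a≢b)))
      ≡⟨ cong (λ w → sg a * Y a * (sg (punchOut a≢b) * X b * w))
              (det-cong k (λ r c → cong (B r) (punchIn-punchOut-comm a b a≢b b≢a c))) ⟩
    sg a * Y a * (sg (punchOut a≢b) * X b * w)
      ≡⟨ regroup (sg a) (sg (punchOut a≢b)) (X b) (Y a) w ⟩
    (sg a * sg (punchOut a≢b)) * (X b * Y a * w)
      ≡⟨ cong (_* (X b * Y a * w)) (sign-punchOut-anticomm a b a≢b b≢a) ⟩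
    - (sg b * sg (punchOut b≢a)) * (X b * Y a * w)
      ≡⟨ regroup⁻ (sg b) (sg (punchOut b≢a)) (X b) (Y a) w ⟩
    - (sg b * X b * (sg (punchOut b≢a) * Y a * w)) ∎
    where
    w = minor (punchIn b ∘ punchIn (punchOut b≢a))
    regroup : ∀ s t x y w → s * y * (t * x * w) ≡ (s * t) * (x * y * w)
    regroup = solve-∀
    regroup⁻ : ∀ s t x y w → - (s * t) * (x * y * w) ≡ - (s * x * (t * y * w))
    regroup⁻ = solve-∀

swapAdjacent : ∀ {k} → Fin k → Fin (suc k) → Fin (suc k)
swapAdjacent {suc k} zero zero          = suc zero
swapAdjacent {suc k} zero (suc zero)    = zero
swapAdjacent {suc k} zero (suc (suc i)) = suc (suc i)
swapAdjacent (suc r) zero    = zero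
swapAdjacent (suc r) (suc i) = suc (swapAdjacent r i)

det-swapRows : ∀ k (r : Fin k) (M : Matrix (suc k)) → det (suc k) (λ i j → M (swapAdjacent r i) j) ≡ - det (suc k) M
det-swapRows (suc k) zero M = trans (det-cong (suc (suc k)) swapped)
  (trans (det-stack-swap (M zero) (M (suc zero)) (λ r → M (suc (suc r)))) (cong -_ (det-cong (suc (suc k)) unstacked)))
  where
  swapped : ∀ i j → M (swapAdjacent zero i) j ≡ stack (M (suc zero)) (M zero) (λ r → M (suc (suc r))) i j
  swapped zero          j = refl
  swapped (suc zero)    j = refl
  swapped (suc (suc i)) j = refl
  unstacked : ∀ i j → stack (M zero) (M (suc zero)) (λ r → M (suc (suc r))) i j ≡ M i j
  unstacked zero          j = refl
  unstacked (suc zero)    j = refl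
  unstacked (suc (suc i)) j = refl
det-swapRows (suc k) (suc r) M = trans
  (Σ-cong (suc (suc k)) (λ j → cong (sg j * M zero j *_) (det-swapRows k r (λ a c → M (suc a) (punchIn j c)))))
  (trans (Σ-cong (suc (suc k)) (λ j → sym (ℤP.neg-distribʳ-* (sg j * M zero j) (det (suc k) (λ a c → M (suc a) (punchIn j c))))))
         (Σ-neg (suc (suc k)) (λ j → sg j * M zero j * det (suc k) (λ a c → M (suc a) (punchIn j c)))))

det-swapCols : ∀ k (r : Fin k) (M : Matrix (suc k)) → det (suc k) (λ i j → M i (swapAdjacent r j)) ≡ - det (suc k) M
det-swapCols k r M = trans (sym (det-transpose (suc k) (λ i j → M i (swapAdjacent r j))))
  (trans (det-swapRows k r (λ i j → M j i)) (cong -_ (det-transpose (suc k) M)))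

det-conjSwap : ∀ k (r : Fin k) (M : Matrix (suc k)) →
  det (suc k) (λ i j → M (swapAdjacent r i) (swapAdjacent r j)) ≡ det (suc k) M
det-conjSwap k r M = trans (det-swapRows k r (λ i j → M i (swapAdjacent r j)))
  (trans (cong -_ (det-swapCols k r M)) (ℤP.neg-involutive _))

det-equalCols₀₁ : ∀ k (M : Matrix (suc (suc k))) → (∀ i → M i zero ≡ M i (suc zero)) → det (suc (suc k)) M ≡ + 0
det-equalCols₀₁ k M cols≡ = self-negative (trans (sym (det-cong (suc (suc k)) swap-invariant)) (det-swapCols (suc k) zero M))
  where
  swap-invariant : ∀ i j → M i (swapAdjacent zero j) ≡ M i j
  swap-invariant i zero          = sym (cols≡ i)
  swap-invariant i (suc zero)    = cols≡ i
  swap-invariant i (suc (suc j)) = refl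
  self-negative : ∀ {d} → d ≡ - d → d ≡ + 0
  self-negative {+ zero}    _ = refl
  self-negative {+ suc _}   ()
  self-negative {ℤ.-[1+ _ ]} ()

-- moveToFront j lists the indices as j, 0, 1, …, j - 1, j + 1, …
moveToFront : ∀ {k} → Fin (suc k) → Fin (suc k) → Fin (suc k)
moveToFront j zero    = j
moveToFront j (suc i) = punchIn j i

moveToFront-injective : ∀ {k} (j : Fin (suc k)) a b → moveToFront j a ≡ moveToFront j b → a ≡ b
moveToFront-injective j zero    zero    _  = refl
moveToFront-injective j zero    (suc b) eq = ⊥-elim (punchInᵢ≢i j b (sym eq))
moveToFront-injective j (suc a) zero    eq = ⊥-elim (punchInᵢ≢i j a eq)
moveToFront-injective j (suc a) (suc b) eq = cong suc (punchIn-injective j a b eq)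

moveToFront-suc : ∀ {k} (j : Fin k) i → moveToFront (suc j) i ≡ swapAdjacent j (moveToFront (inject₁ j) i)
moveToFront-suc j zero    = sym (swap-inject₁ j)
  where
  swap-inject₁ : ∀ {k} (j : Fin k) → swapAdjacent j (inject₁ j) ≡ suc j
  swap-inject₁ {suc k} zero = refl
  swap-inject₁ (suc j)      = cong suc (swap-inject₁ j)
moveToFront-suc j (suc i) = sym (swap-punchIn j i)
  where
  swap-punchIn : ∀ {k} (j i : Fin k) → swapAdjacent j (punchIn (inject₁ j) i) ≡ punchIn (suc j) i
  swap-punchIn {suc k} zero    zero    = refl
  swap-punchIn {suc k} zero    (suc i) = refl
  swap-punchIn (suc j)         zero    = refl
  swap-punchIn (suc j)         (suc i) = cong suc (swap-punchIn j i)

det-moveToFront : ∀ k (j : Fin (suc k)) (M : Matrix (suc k)) →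
  det (suc k) (λ a b → M (moveToFront j a) (moveToFront j b)) ≡ det (suc k) M
det-moveToFront k j M = go k (toℕ j) j refl M
  where
  go : ∀ k m (j : Fin (suc k)) → toℕ j ≡ m → (M : Matrix (suc k)) →
    det (suc k) (λ a b → M (moveToFront j a) (moveToFront j b)) ≡ det (suc k) M
  go k m zero _ M = det-cong (suc k) {M = λ a b → M (moveToFront zero a) (moveToFront zero b)} {N = M}
    λ { zero zero → refl ; zero (suc b) → refl ; (suc a) zero → refl ; (suc a) (suc b) → refl }
  go (suc k) (suc m) (suc j) j≡m M = begin
    det (suc (suc k)) (λ a b → M (moveToFront (suc j) a) (moveToFront (suc j) b))
      ≡⟨ det-cong (suc (suc k)) (λ a b → cong₂ M (moveToFront-suc j a) (moveToFront-suc j b)) ⟩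
    det (suc (suc k)) (λ a b → M′ (moveToFront (inject₁ j) a) (moveToFront (inject₁ j) b))
      ≡⟨ go (suc k) m (inject₁ j) (trans (toℕ-inject₁ j) (ℕP.suc-injective j≡m)) M′ ⟩
    det (suc (suc k)) M′
      ≡⟨ det-conjSwap (suc k) j M ⟩
    det (suc (suc k)) M ∎
    where
    open ≡-Reasoning
    M′ : Matrix (suc (suc k))
    M′ a b = M (swapAdjacent j a) (swapAdjacent j b)

module TypedMatrix {T : Set} (G : T → ℤ) (F : T → T → ℤ) where

  typedMatrix : ∀ {k} → (Fin k → T) → Matrix k
  typedMatrix t a b = δ a b * G (t a) + F (t a) (t b)

  typedDet : ∀ k → (Fin k → T) → ℤ
  typedDet k t = det k (typedMatrix t)

  typedMatrix-suc : ∀ {k} (t : Fin (suc k) → T) a b → typedMatrix t (suc a) (suc b) ≡ typedMatrix (tail t) a b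
  typedMatrix-suc t a b = cong (λ d → d * G (t (suc a)) + F (t (suc a)) (t (suc b))) (δ-injective suc (λ _ _ → suc-injective) a b)

  typedDet-cong : ∀ k {t u : Fin k → T} → (∀ i → t i ≡ u i) → typedDet k t ≡ typedDet k u
  typedDet-cong k t≗u = det-cong k (λ a b → cong₂ (λ x y → δ a b * G x + F x y) (t≗u a) (t≗u b))

  typedDet-moveToFront : ∀ k (t : Fin (suc k) → T) j → typedDet (suc k) (t ∘ moveToFront j) ≡ typedDet (suc k) t
  typedDet-moveToFront k t j = trans
    (det-cong (suc k) (λ a b → cong (λ d → d * G (t (moveToFront j a)) + F (t (moveToFront j a)) (t (moveToFront j b)))
                                     (sym (δ-injective (moveToFront j) (moveToFront-injective j) a b))))
    (det-moveToFront k j (typedMatrix t))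

  typedDet-isolated : ∀ k (t : Fin (suc k) → T) → (∀ j → F (t zero) (t (suc j)) ≡ + 0) →
    typedDet (suc k) t ≡ (G (t zero) + F (t zero) (t zero)) * typedDet k (tail t)
  typedDet-isolated k t row₀ = begin
    + 1 * (+ 1 * g + F (t zero) (t zero)) * det k (λ r c → typedMatrix t (suc r) (suc c))
      + Σ k (λ j → sg (suc j) * (+ 0 * g + F (t zero) (t (suc j))) * minor j)
      ≡⟨ cong₂ _+_ (cong (+ 1 * (+ 1 * g + F (t zero) (t zero)) *_) (det-cong k (typedMatrix-suc t)))
                   (trans (Σ-cong k (λ j → cong (λ f → sg (suc j) * (+ 0 * g + f) * minor j) (row₀ j)))
                          (trans (Σ-cong k (λ j → vanish (sg (suc j)) g (minor j))) (Σ-zero k))) ⟩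
    + 1 * (+ 1 * g + F (t zero) (t zero)) * typedDet k (tail t) + + 0
      ≡⟨ normalise g (F (t zero) (t zero)) (typedDet k (tail t)) ⟩
    (g + F (t zero) (t zero)) * typedDet k (tail t) ∎
    where
    open ≡-Reasoning
    g = G (t zero)
    minor : Fin k → ℤ
    minor j = det k (λ r c → typedMatrix t (suc r) (punchIn (suc j) c))
    vanish : ∀ s g d → s * (+ 0 * g + + 0) * d ≡ + 0
    vanish = solve-∀
    normalise : ∀ g f d → + 1 * (+ 1 * g + f) * d + + 0 ≡ (g + f) * d
    normalise = solve-∀

  typedDet-pendant : ∀ k (t : Fin (suc (suc k)) → T) →
    F (t zero) (t (suc zero)) ≡ + 1 → F (t (suc zero)) (t zero) ≡ + 1 →
    (∀ j → F (t zero) (t (suc (suc j))) ≡ + 0) → (∀ j → F (t (suc (suc j))) (t zero) ≡ + 0) →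
    typedDet (suc (suc k)) t
      ≡ (G (t zero) + F (t zero) (t zero)) * typedDet (suc k) (tail t) - typedDet k (tail (tail t))
  typedDet-pendant k t F₀₁ F₁₀ row₀ col₀ = begin
    + 1 * (+ 1 * g + F (t zero) (t zero)) * det (suc k) (λ r c → M (suc r) (suc c))
      + (- + 1 * (+ 0 * g + F (t zero) (t (suc zero))) * det (suc k) M₁ + Σ k rest)
      ≡⟨ cong₂ _+_ (cong (+ 1 * (+ 1 * g + F (t zero) (t zero)) *_) (det-cong (suc k) (typedMatrix-suc t)))
                   (cong₂ _+_ (cong₂ (λ f d → - + 1 * (+ 0 * g + f) * d) F₀₁ det-M₁)
                              (trans (Σ-cong k rest-vanishes) (Σ-zero k))) ⟩
    + 1 * (+ 1 * g + F (t zero) (t zero)) * typedDet (suc k) (tail t)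
      + (- + 1 * (+ 0 * g + + 1) * typedDet k (tail (tail t)) + + 0)
      ≡⟨ normalise g (F (t zero) (t zero)) (typedDet (suc k) (tail t)) (typedDet k (tail (tail t))) ⟩
    (g + F (t zero) (t zero)) * typedDet (suc k) (tail t) - typedDet k (tail (tail t)) ∎
    where
    open ≡-Reasoning
    g = G (t zero)
    M = typedMatrix t
    M₁ : Matrix (suc k)
    M₁ r c = M (suc r) (punchIn (suc zero) c)
    rest : Fin k → ℤ
    rest j = sg (suc (suc j)) * M zero (suc (suc j)) * det (suc k) (λ r c → M (suc r) (punchIn (suc (suc j)) c))
    rest-vanishes : ∀ j → rest j ≡ + 0
    rest-vanishes j =
      trans (cong (λ f → sg (suc (suc j)) * (+ 0 * g + f) * det (suc k) (λ r c → M (suc r) (punchIn (suc (suc j)) c))) (row₀ j))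
                            (vanish (sg (suc (suc j))) g _)
      where vanish : ∀ s g d → s * (+ 0 * g + + 0) * d ≡ + 0
            vanish = solve-∀
    det-M₁ : det (suc k) M₁ ≡ typedDet k (tail (tail t))
    det-M₁ = begin
      det (suc k) M₁
        ≡⟨ det-expandColumn₀ k M₁ ⟩
      + 1 * (+ 0 * G (t (suc zero)) + F (t (suc zero)) (t zero)) * det k (λ r c → M₁ (suc r) (suc c))
        + Σ k (λ i → sg (suc i) * (+ 0 * G (t (suc (suc i))) + F (t (suc (suc i))) (t zero)) * minor i)
        ≡⟨ cong₂ _+_ (cong₂ (λ f d → + 1 * (+ 0 * G (t (suc zero)) + f) * d) F₁₀
                            (det-cong k (λ r c → trans (typedMatrix-suc t (suc r) (suc c)) (typedMatrix-suc (tail t) r c))))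
                     (trans (Σ-cong k (λ i → trans (cong (λ f → sg (suc i) * (+ 0 * G (t (suc (suc i))) + f) * minor i) (col₀ i))
                                                   (vanish (sg (suc i)) (G (t (suc (suc i)))) (minor i))))
                            (Σ-zero k)) ⟩
      + 1 * (+ 0 * G (t (suc zero)) + + 1) * typedDet k (tail (tail t)) + + 0
        ≡⟨ unit (G (t (suc zero))) (typedDet k (tail (tail t))) ⟩
      typedDet k (tail (tail t)) ∎
      where
      minor : Fin k → ℤ
      minor i = det k (λ r c → M₁ (punchIn (suc i) r) (suc c))
      vanish : ∀ s g d → s * (+ 0 * g + + 0) * d ≡ + 0
      vanish = solve-∀
      unit : ∀ g d → + 1 * (+ 0 * g + + 1) * d + + 0 ≡ d
      unit = solve-∀
    normalise : ∀ g f a b → + 1 * (+ 1 * g + f) * a + (- + 1 * (+ 0 * g + + 1) * b + + 0) ≡ (g + f) * a - b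
    normalise = solve-∀

  -- When the first two indices have the same type, columns 0 and 1 differ only on the two
  -- diagonal entries, so subtracting column 1 from column 0 leaves ± G on rows 0 and 1 only.
  typedDet-repeated : ∀ k (t : Fin (suc (suc k)) → T) → t zero ≡ t (suc zero) →
    typedDet (suc (suc k)) t
      ≡ G (t zero) * typedDet (suc k) (tail t)
        + G (t zero) * (typedDet (suc k) (tail t) - G (t zero) * typedDet k (tail (tail t)))
  typedDet-repeated k t t₀≡t₁ = begin
    det n M
      ≡⟨ ℤP.+-identityʳ _ ⟨
    det n M + + 0
      ≡⟨ cong (λ d → det n M + - d) (det-equalCols₀₁ k M′ (λ _ → refl)) ⟨
    det n M - det n M′
      ≡⟨ cong₂ _-_ (det-expandColumn₀ (suc k) M) (det-expandColumn₀ (suc k) M′) ⟩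
    Σ n (λ i → sg i * M i zero * m i) - Σ n (λ i → sg i * M i (suc zero) * m i)
      ≡⟨ Σ-difference n (λ i → sg i * M i zero * m i) (λ i → sg i * M i (suc zero) * m i) ⟨
    Σ n (λ i → sg i * M i zero * m i - sg i * M i (suc zero) * m i)
      ≡⟨ Σ-cong n (λ i → factor (sg i) (M i zero) (M i (suc zero)) (m i)) ⟩
    Σ n (λ i → sg i * (M i zero - M i (suc zero)) * m i)
      ≡⟨ cong₂ _+_ row₀ (cong₂ _+_ row₁ (trans (Σ-cong k rows≥2) (Σ-zero k))) ⟩
    g * m zero + (g * m (suc zero) + + 0)
      ≡⟨ cong₂ _+_ (cong (g *_) m₀) (trans (ℤP.+-identityʳ _) (cong (g *_) m₁)) ⟩
    g * typedDet (suc k) (tail t) + g * (typedDet (suc k) (tail t) - g * typedDet k (tail (tail t))) ∎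
    where
    open ≡-Reasoning
    n = suc (suc k)
    M : Matrix n
    M = typedMatrix t
    g = G (t zero)
    M′ : Matrix n
    M′ i zero    = M i (suc zero)
    M′ i (suc j) = M i (suc j)
    m : Fin n → ℤ
    m i = det (suc k) (λ r c → M (punchIn i r) (suc c))
    factor : ∀ s a b x → s * a * x - s * b * x ≡ s * (a - b) * x
    factor = solve-∀
    same-F : ∀ a → F a (t zero) ≡ F a (t (suc zero))
    same-F a = cong (F a) t₀≡t₁
    row₀ : + 1 * (M zero zero - M zero (suc zero)) * m zero ≡ g * m zero
    row₀ = cancel g (m zero) (same-F (t zero))
      where cancel : ∀ g x {f f′} → f ≡ f′ → + 1 * (+ 1 * g + f - (+ 0 * g + f′)) * x ≡ g * x
            cancel g x {f} refl = ring g x f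
              where ring : ∀ g x f → + 1 * (+ 1 * g + f - (+ 0 * g + f)) * x ≡ g * x
                    ring = solve-∀
    row₁ : - + 1 * (M (suc zero) zero - M (suc zero) (suc zero)) * m (suc zero) ≡ g * m (suc zero)
    row₁ = cancel g (m (suc zero)) (cong G (sym t₀≡t₁)) (same-F (t (suc zero)))
      where cancel : ∀ g x {g′ f f′} → g′ ≡ g → f ≡ f′ → - + 1 * (+ 0 * g′ + f - (+ 1 * g′ + f′)) * x ≡ g * x
            cancel g x {f = f} refl refl = ring g x f
              where ring : ∀ g x f → - + 1 * (+ 0 * g + f - (+ 1 * g + f)) * x ≡ g * x
                    ring = solve-∀
    rows≥2 : ∀ i → sg (suc (suc i)) * (M (suc (suc i)) zero - M (suc (suc i)) (suc zero)) * m (suc (suc i)) ≡ + 0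
    rows≥2 i = cancel (sg (suc (suc i))) (G (t (suc (suc i)))) (m (suc (suc i))) (same-F (t (suc (suc i))))
      where cancel : ∀ s g x {f f′} → f ≡ f′ → s * (+ 0 * g + f - (+ 0 * g + f′)) * x ≡ + 0
            cancel s g x {f} refl = ring s g x f
              where ring : ∀ s g x f → s * (+ 0 * g + f - (+ 0 * g + f)) * x ≡ + 0
                    ring = solve-∀
    m₀ : m zero ≡ typedDet (suc k) (tail t)
    m₀ = det-cong (suc k) (typedMatrix-suc t)
    m₁ : m (suc zero) ≡ typedDet (suc k) (tail t) - g * typedDet k (tail (tail t))
    m₁ = begin
      Σ (suc k) (λ j → sg j * M zero (suc j) * d j)
        ≡⟨ Σ-cong (suc k) row-split ⟩
      Σ (suc k) (λ j → sg j * typedMatrix (tail t) zero j * d j - sg j * (δ zero j * g) * d j)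
        ≡⟨ Σ-difference (suc k) (λ j → sg j * typedMatrix (tail t) zero j * d j) (λ j → sg j * (δ zero j * g) * d j) ⟩
      Σ (suc k) (λ j → sg j * typedMatrix (tail t) zero j * d j) - Σ (suc k) (λ j → sg j * (δ zero j * g) * d j)
        ≡⟨ cong₂ _-_ (Σ-cong (suc k) (λ j → cong (sg j * typedMatrix (tail t) zero j *_)
                                                 (det-cong k (λ r c → typedMatrix-suc t (suc r) (punchIn j c)))))
                     diagonal-part ⟩
      typedDet (suc k) (tail t) - g * typedDet k (tail (tail t)) ∎
      where
      d : Fin (suc k) → ℤ
      d j = det k (λ r c → M (suc (suc r)) (suc (punchIn j c)))
      row-split : ∀ j → sg j * M zero (suc j) * d j
                      ≡ sg j * typedMatrix (tail t) zero j * d j - sg j * (δ zero j * g) * d j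
      row-split j = split (sg j) (δ zero j) (d j) (cong G t₀≡t₁) (cong (λ a → F a (t (suc j))) t₀≡t₁)
        where
        split : ∀ s e x {g g′ f f′} → g ≡ g′ → f ≡ f′ → s * (+ 0 * g + f) * x ≡ s * (e * g′ + f′) * x - s * (e * g) * x
        split s e x {g} {f = f} refl refl = ring s e x g f
          where ring : ∀ s e x g f → s * (+ 0 * g + f) * x ≡ s * (e * g + f) * x - s * (e * g) * x
                ring = solve-∀
      diagonal-part : Σ (suc k) (λ j → sg j * (δ zero j * g) * d j) ≡ g * typedDet k (tail (tail t))
      diagonal-part = begin
        + 1 * (+ 1 * g) * d zero + Σ k (λ j → sg (suc j) * (+ 0 * g) * d (suc j))
          ≡⟨ cong₂ _+_ (unit g (d zero)) (trans (Σ-cong k (λ j → vanish (sg (suc j)) g (d (suc j)))) (Σ-zero k)) ⟩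
        g * d zero + + 0
          ≡⟨ ℤP.+-identityʳ (g * d zero) ⟩
        g * d zero
          ≡⟨ cong (g *_) (det-cong k (λ r c → trans (typedMatrix-suc t (suc r) (suc c)) (typedMatrix-suc (tail t) r c))) ⟩
        g * typedDet k (tail (tail t)) ∎
        where
        unit : ∀ g x → + 1 * (+ 1 * g) * x ≡ g * x
        unit = solve-∀
        vanish : ∀ s g x → s * (+ 0 * g) * x ≡ + 0
        vanish = solve-∀

occurrences-extract : ∀ k (t : Fin (suc k) → Class) j c →
  occurrences t c ≡ indicator (t j) c ℕ.+ occurrences (t ∘ punchIn j) c
occurrences-extract k       t zero    c = refl
occurrences-extract (suc k) t (suc j) c = begin
  indicator (t zero) c ℕ.+ occurrences (tail t) c
    ≡⟨ cong (ℕ._+_ (indicator (t zero) c)) (occurrences-extract k (tail t) j c) ⟩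
  indicator (t zero) c ℕ.+ (indicator (t (suc j)) c ℕ.+ occurrences (tail t ∘ punchIn j) c)
    ≡⟨ x∙yz≈y∙xz (indicator (t zero) c) (indicator (t (suc j)) c) _ ⟩
  indicator (t (suc j)) c ℕ.+ (indicator (t zero) c ℕ.+ occurrences (tail t ∘ punchIn j) c) ∎
  where open ≡-Reasoning

occurrences-moveToFront : ∀ k (t : Fin (suc k) → Class) j c → occurrences (t ∘ moveToFront j) c ≡ occurrences t c
occurrences-moveToFront k t j c = sym (occurrences-extract k t j c)

-- For the m × m all-ones matrix J, cliqueDet g m = det (g I + J) = g ^ (m - 1) (g + m) and
-- cliqueCofactors g m = m g ^ (m - 1) is the sum of all cofactors of g I + J.
cliqueDet cliqueCofactors : ℤ → ℕ → ℤ
cliqueDet g zero          = + 1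
cliqueDet g (suc zero)    = g + + 1
cliqueDet g (suc (suc m)) = g * cliqueDet g (suc m) + g * (cliqueDet g (suc m) - g * cliqueDet g m)
cliqueCofactors g zero          = + 0
cliqueCofactors g (suc zero)    = + 1
cliqueCofactors g (suc (suc m)) =
  g * cliqueCofactors g (suc m) + g * (cliqueCofactors g (suc m) - g * cliqueCofactors g m)

cliqueDet-closed : ∀ g m → cliqueDet g (suc m) ≡ g ^ m * (g + + suc m)
cliqueDet-closed g zero          = ring g
  where ring : ∀ g → g + + 1 ≡ + 1 * (g + + 1)
        ring = solve-∀
cliqueDet-closed g (suc zero)    = ring g
  where ring : ∀ g → g * (g + + 1) + g * (g + + 1 - g * + 1) ≡ g * + 1 * (g + + 2)
        ring = solve-∀
cliqueDet-closed g (suc (suc m)) rewrite cliqueDet-closed g (suc m) | cliqueDet-closed g m = ring g (g ^ m) (+ m)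
  where ring : ∀ g P k → g * (g * P * (g + (+ 2 + k))) + g * (g * P * (g + (+ 2 + k)) - g * (P * (g + (+ 1 + k))))
                         ≡ g * (g * P) * (g + (+ 3 + k))
        ring = solve-∀

cliqueCofactors-closed : ∀ g m → cliqueCofactors g (suc m) ≡ + suc m * g ^ m
cliqueCofactors-closed g zero          = refl
cliqueCofactors-closed g (suc zero)    = ring g
  where ring : ∀ g → g * + 1 + g * (+ 1 - g * + 0) ≡ + 2 * (g * + 1)
        ring = solve-∀
cliqueCofactors-closed g (suc (suc m)) rewrite cliqueCofactors-closed g (suc m) | cliqueCofactors-closed g m = ring g (g ^ m) (+ m)
  where ring : ∀ g P k → g * ((+ 2 + k) * (g * P)) + g * ((+ 2 + k) * (g * P) - g * ((+ 1 + k) * P))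
                         ≡ (+ 3 + k) * (g * (g * P))
        ring = solve-∀

module StarDeterminant (G : Class → ℤ) where

  open TypedMatrix G starAdj public

  blockDet blockCofactors : (Class → ℕ) → Class → ℤ
  blockDet m c = cliqueDet (G c) (m c)
  blockCofactors m c = cliqueCofactors (G c) (m c)

  -- By the matrix determinant lemma applied to the central block, this is the determinant of the
  -- typed matrix with block sizes m, h c and k c being det (G c I + J) and its cofactor sum.
  starPoly : (Class → ℕ) → ℤ
  starPoly m = h central * h rotation * h reflection₀ * h reflection₁
             - k central * (k rotation * h reflection₀ * h reflection₁
                            + h rotation * k reflection₀ * h reflection₁
                            + h rotation * h reflection₀ * k reflection₁)
    where
    h = blockDet m
    k = blockCofactors m

  starPoly-cong : ∀ {m m′} → (∀ c → m c ≡ m′ c) → starPoly m ≡ starPoly m′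
  starPoly-cong m≗m′ rewrite m≗m′ central | m≗m′ rotation | m≗m′ reflection₀ | m≗m′ reflection₁ = refl

  -- starPoly is linear in the pair (h c , k c) of each block, and cliqueDet and cliqueCofactors
  -- obey the same two-step recurrence.
  private
    recurrence₀ : ∀ g a a′ b b′ h₁ k₁ h₂ k₂ h₃ k₃ →
      let C : ℤ → ℤ → ℤ
          C h₀ k₀ = h₀ * h₁ * h₂ * h₃ - k₀ * (k₁ * h₂ * h₃ + h₁ * k₂ * h₃ + h₁ * h₂ * k₃)
          R : ℤ → ℤ → ℤ
          R x x′ = g * x′ + g * (x′ - g * x)
      in C (R a a′) (R b b′) ≡ g * C a′ b′ + g * (C a′ b′ - g * C a b)
    recurrence₀ = solve-∀
    recurrence₁ : ∀ g a a′ b b′ h₀ k₀ h₂ k₂ h₃ k₃ →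
      let C : ℤ → ℤ → ℤ
          C h₁ k₁ = h₀ * h₁ * h₂ * h₃ - k₀ * (k₁ * h₂ * h₃ + h₁ * k₂ * h₃ + h₁ * h₂ * k₃)
          R : ℤ → ℤ → ℤ
          R x x′ = g * x′ + g * (x′ - g * x)
      in C (R a a′) (R b b′) ≡ g * C a′ b′ + g * (C a′ b′ - g * C a b)
    recurrence₁ = solve-∀
    recurrence₂ : ∀ g a a′ b b′ h₀ k₀ h₁ k₁ h₃ k₃ →
      let C : ℤ → ℤ → ℤ
          C h₂ k₂ = h₀ * h₁ * h₂ * h₃ - k₀ * (k₁ * h₂ * h₃ + h₁ * k₂ * h₃ + h₁ * h₂ * k₃)
          R : ℤ → ℤ → ℤ
          R x x′ = g * x′ + g * (x′ - g * x)
      in C (R a a′) (R b b′) ≡ g * C a′ b′ + g * (C a′ b′ - g * C a b)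
    recurrence₂ = solve-∀
    recurrence₃ : ∀ g a a′ b b′ h₀ k₀ h₁ k₁ h₂ k₂ →
      let C : ℤ → ℤ → ℤ
          C h₃ k₃ = h₀ * h₁ * h₂ * h₃ - k₀ * (k₁ * h₂ * h₃ + h₁ * k₂ * h₃ + h₁ * h₂ * k₃)
          R : ℤ → ℤ → ℤ
          R x x′ = g * x′ + g * (x′ - g * x)
      in C (R a a′) (R b b′) ≡ g * C a′ b′ + g * (C a′ b′ - g * C a b)
    recurrence₃ = solve-∀

  starPoly-repeated : ∀ c m →
    starPoly (addOne c (addOne c m)) ≡ G c * starPoly (addOne c m) + G c * (starPoly (addOne c m) - G c * starPoly m)
  starPoly-repeated c@central m = recurrence₀ (G c) (h c) (h′ c) (k c) (k′ c)
    (h rotation) (k rotation) (h reflection₀) (k reflection₀) (h reflection₁) (k reflection₁)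
    where h = blockDet m; k = blockCofactors m; h′ = blockDet (addOne c m); k′ = blockCofactors (addOne c m)
  starPoly-repeated c@rotation m = recurrence₁ (G c) (h c) (h′ c) (k c) (k′ c)
    (h central) (k central) (h reflection₀) (k reflection₀) (h reflection₁) (k reflection₁)
    where h = blockDet m; k = blockCofactors m; h′ = blockDet (addOne c m); k′ = blockCofactors (addOne c m)
  starPoly-repeated c@reflection₀ m = recurrence₂ (G c) (h c) (h′ c) (k c) (k′ c)
    (h central) (k central) (h rotation) (k rotation) (h reflection₁) (k reflection₁)
    where h = blockDet m; k = blockCofactors m; h′ = blockDet (addOne c m); k′ = blockCofactors (addOne c m)
  starPoly-repeated c@reflection₁ m = recurrence₃ (G c) (h c) (h′ c) (k c) (k′ c)
    (h central) (k central) (h rotation) (k rotation) (h reflection₀) (k reflection₀)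
    where h = blockDet m; k = blockCofactors m; h′ = blockDet (addOne c m); k′ = blockCofactors (addOne c m)

  private
    isolated₁ : ∀ g h₂ k₂ h₃ k₃ →
      let C : ℤ → ℤ → ℤ → ℤ → ℤ
          C h₀ k₀ h₁ k₁ = h₀ * h₁ * h₂ * h₃ - k₀ * (k₁ * h₂ * h₃ + h₁ * k₂ * h₃ + h₁ * h₂ * k₃)
      in C (+ 1) (+ 0) (g + + 1) (+ 1) ≡ (g + + 1) * C (+ 1) (+ 0) (+ 1) (+ 0)
    isolated₁ = solve-∀
    isolated₂ : ∀ g h₁ k₁ h₃ k₃ →
      let C : ℤ → ℤ → ℤ → ℤ → ℤ
          C h₀ k₀ h₂ k₂ = h₀ * h₁ * h₂ * h₃ - k₀ * (k₁ * h₂ * h₃ + h₁ * k₂ * h₃ + h₁ * h₂ * k₃)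
      in C (+ 1) (+ 0) (g + + 1) (+ 1) ≡ (g + + 1) * C (+ 1) (+ 0) (+ 1) (+ 0)
    isolated₂ = solve-∀
    isolated₃ : ∀ g h₁ k₁ h₂ k₂ →
      let C : ℤ → ℤ → ℤ → ℤ → ℤ
          C h₀ k₀ h₃ k₃ = h₀ * h₁ * h₂ * h₃ - k₀ * (k₁ * h₂ * h₃ + h₁ * k₂ * h₃ + h₁ * h₂ * k₃)
      in C (+ 1) (+ 0) (g + + 1) (+ 1) ≡ (g + + 1) * C (+ 1) (+ 0) (+ 1) (+ 0)
    isolated₃ = solve-∀
    pendant₁ : ∀ g₀ g h₂ k₂ h₃ k₃ →
      let C : ℤ → ℤ → ℤ → ℤ → ℤ
          C h₀ k₀ h₁ k₁ = h₀ * h₁ * h₂ * h₃ - k₀ * (k₁ * h₂ * h₃ + h₁ * k₂ * h₃ + h₁ * h₂ * k₃)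
      in C (g₀ + + 1) (+ 1) (g + + 1) (+ 1) ≡ (g + + 1) * C (g₀ + + 1) (+ 1) (+ 1) (+ 0) - C (+ 1) (+ 0) (+ 1) (+ 0)
    pendant₁ = solve-∀
    pendant₂ : ∀ g₀ g h₁ k₁ h₃ k₃ →
      let C : ℤ → ℤ → ℤ → ℤ → ℤ
          C h₀ k₀ h₂ k₂ = h₀ * h₁ * h₂ * h₃ - k₀ * (k₁ * h₂ * h₃ + h₁ * k₂ * h₃ + h₁ * h₂ * k₃)
      in C (g₀ + + 1) (+ 1) (g + + 1) (+ 1) ≡ (g + + 1) * C (g₀ + + 1) (+ 1) (+ 1) (+ 0) - C (+ 1) (+ 0) (+ 1) (+ 0)
    pendant₂ = solve-∀
    pendant₃ : ∀ g₀ g h₁ k₁ h₂ k₂ →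
      let C : ℤ → ℤ → ℤ → ℤ → ℤ
          C h₀ k₀ h₃ k₃ = h₀ * h₁ * h₂ * h₃ - k₀ * (k₁ * h₂ * h₃ + h₁ * k₂ * h₃ + h₁ * h₂ * k₃)
      in C (g₀ + + 1) (+ 1) (g + + 1) (+ 1) ≡ (g + + 1) * C (g₀ + + 1) (+ 1) (+ 1) (+ 0) - C (+ 1) (+ 0) (+ 1) (+ 0)
    pendant₃ = solve-∀

  starPoly-isolated : ∀ c → c ≢ central → ∀ m → m central ≡ 0 → m c ≡ 0 →
    starPoly (addOne c m) ≡ (G c + + 1) * starPoly m
  starPoly-isolated central c≢0 = ⊥-elim (c≢0 refl)
  starPoly-isolated c@rotation _ m m₀ m_c rewrite m₀ | m_c =
    isolated₁ (G c) (h reflection₀) (k reflection₀) (h reflection₁) (k reflection₁)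
    where h = blockDet m; k = blockCofactors m
  starPoly-isolated c@reflection₀ _ m m₀ m_c rewrite m₀ | m_c =
    isolated₂ (G c) (h rotation) (k rotation) (h reflection₁) (k reflection₁)
    where h = blockDet m; k = blockCofactors m
  starPoly-isolated c@reflection₁ _ m m₀ m_c rewrite m₀ | m_c =
    isolated₃ (G c) (h rotation) (k rotation) (h reflection₀) (k reflection₀)
    where h = blockDet m; k = blockCofactors m

  starPoly-pendant : ∀ c → c ≢ central → ∀ m → m central ≡ 0 → m c ≡ 0 →
    starPoly (addOne c (addOne central m)) ≡ (G c + + 1) * starPoly (addOne central m) - starPoly m
  starPoly-pendant central c≢0 = ⊥-elim (c≢0 refl)
  starPoly-pendant c@rotation _ m m₀ m_c rewrite m₀ | m_c =
    pendant₁ (G central) (G c) (h reflection₀) (k reflection₀) (h reflection₁) (k reflection₁)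
    where h = blockDet m; k = blockCofactors m
  starPoly-pendant c@reflection₀ _ m m₀ m_c rewrite m₀ | m_c =
    pendant₂ (G central) (G c) (h rotation) (k rotation) (h reflection₁) (k reflection₁)
    where h = blockDet m; k = blockCofactors m
  starPoly-pendant c@reflection₁ _ m m₀ m_c rewrite m₀ | m_c =
    pendant₃ (G central) (G c) (h rotation) (k rotation) (h reflection₀) (k reflection₀)
    where h = blockDet m; k = blockCofactors m

  StarFormula : ∀ k → (Fin k → Class) → Set
  StarFormula k t = typedDet k t ≡ starPoly (occurrences t)

  starFormula-moveToFront : ∀ k (t : Fin (suc k) → Class) j → StarFormula (suc k) (t ∘ moveToFront j) → StarFormula (suc k) t
  starFormula-moveToFront k t j formula = begin
    typedDet (suc k) t                          ≡⟨ typedDet-moveToFront k t j ⟨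
    typedDet (suc k) (t ∘ moveToFront j)        ≡⟨ formula ⟩
    starPoly (occurrences (t ∘ moveToFront j))  ≡⟨ starPoly-cong (occurrences-moveToFront k t j) ⟩
    starPoly (occurrences t)                    ∎
    where open ≡-Reasoning

  starFormula-single : ∀ (t : Fin 1 → Class) → t zero ≡ central → StarFormula 1 t
  starFormula-single t t₀≡0 = begin
    typedDet 1 t                                ≡⟨ typedDet-cong 1 {t = t} {u = λ _ → central} (λ { zero → t₀≡0 }) ⟩
    typedDet 1 (λ _ → central)                  ≡⟨ ring (G central) ⟩
    starPoly (occurrences {1} (λ _ → central))
      ≡⟨ starPoly-cong (occurrences-cong 1 {t = λ _ → central} {u = t} (λ { zero → sym t₀≡0 })) ⟩
    starPoly (occurrences t)                    ∎
    where
    open ≡-Reasoning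
    ring : ∀ g → + 1 * (+ 1 * g + + 1) * + 1 + + 0
               ≡ (g + + 1) * + 1 * + 1 * + 1 - + 1 * (+ 0 * + 1 * + 1 + + 1 * + 0 * + 1 + + 1 * + 1 * + 0)
    ring = solve-∀

  starFormula-isolated : ∀ k (t : Fin (suc k) → Class) → t zero ≢ central → (∀ j → t (suc j) ≢ central) →
    (∀ j → t (suc j) ≢ t zero) → StarFormula k (tail t) → StarFormula (suc k) t
  starFormula-isolated k t t₀≢0 tₛ≢0 tₛ≢t₀ formula = begin
    typedDet (suc k) t
      ≡⟨ typedDet-isolated k t (λ j → starAdj-≢ t₀≢0 (tₛ≢0 j) (tₛ≢t₀ j ∘ sym)) ⟩
    (G (t zero) + starAdj (t zero) (t zero)) * typedDet k (tail t)
      ≡⟨ cong₂ (λ a d → (G (t zero) + a) * d) (starAdj-refl (t zero)) formula ⟩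
    (G (t zero) + + 1) * starPoly (occurrences (tail t))
      ≡⟨ starPoly-isolated (t zero) t₀≢0 (occurrences (tail t))
           (occurrences-absent k (tail t) central tₛ≢0) (occurrences-absent k (tail t) (t zero) tₛ≢t₀) ⟨
    starPoly (occurrences t) ∎
    where open ≡-Reasoning

  starFormula-pendant : ∀ k (t : Fin (suc (suc k)) → Class) → t zero ≢ central → t (suc zero) ≡ central →
    (∀ j → t (suc (suc j)) ≢ central) → (∀ j → t (suc (suc j)) ≢ t zero) →
    StarFormula (suc k) (tail t) → StarFormula k (tail (tail t)) → StarFormula (suc (suc k)) t
  starFormula-pendant k t u≢0 t₁≡0 rest≢0 rest≢u formula₁ formula₂ = begin
    typedDet (suc (suc k)) t
      ≡⟨ typedDet-pendant k t (trans (cong (starAdj u) t₁≡0) (starAdj-centralʳ u)) (cong (λ a → starAdj a u) t₁≡0)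
           (λ j → starAdj-≢ u≢0 (rest≢0 j) (rest≢u j ∘ sym)) (λ j → starAdj-≢ (rest≢0 j) u≢0 (rest≢u j)) ⟩
    (G u + starAdj u u) * typedDet (suc k) (tail t) - typedDet k (tail (tail t))
      ≡⟨ cong₂ (λ a b → (G u + a) * b - typedDet k (tail (tail t))) (starAdj-refl u) formula₁ ⟩
    (G u + + 1) * starPoly (occurrences (tail t)) - typedDet k (tail (tail t))
      ≡⟨ cong (_-_ ((G u + + 1) * starPoly (occurrences (tail t)))) formula₂ ⟩
    (G u + + 1) * starPoly (occurrences (tail t)) - starPoly m
      ≡⟨ cong (λ p → (G u + + 1) * p - starPoly m) (starPoly-cong (λ c → cong (λ a → indicator a c ℕ.+ m c) t₁≡0)) ⟩
    (G u + + 1) * starPoly (addOne central m) - starPoly m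
      ≡⟨ starPoly-pendant u u≢0 m (occurrences-absent k (tail (tail t)) central rest≢0)
                                  (occurrences-absent k (tail (tail t)) u rest≢u) ⟨
    starPoly (addOne u (addOne central m))
      ≡⟨ starPoly-cong (λ c → cong (λ a → indicator u c ℕ.+ (indicator a c ℕ.+ m c)) t₁≡0) ⟨
    starPoly (occurrences t) ∎
    where
    open ≡-Reasoning
    u = t zero
    m = occurrences (tail (tail t))

  starFormula-repeated : ∀ k (t : Fin (suc (suc k)) → Class) → t zero ≡ t (suc zero) →
    StarFormula (suc k) (tail t) → StarFormula k (tail (tail t)) → StarFormula (suc (suc k)) t
  starFormula-repeated k t t₀≡t₁ formula₁ formula₂ = begin
    typedDet (suc (suc k)) t
      ≡⟨ typedDet-repeated k t t₀≡t₁ ⟩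
    g * typedDet (suc k) (tail t) + g * (typedDet (suc k) (tail t) - g * typedDet k (tail (tail t)))
      ≡⟨ cong₂ (λ a b → g * a + g * (a - g * b)) formula₁ formula₂ ⟩
    g * starPoly (occurrences (tail t)) + g * (starPoly (occurrences (tail t)) - g * starPoly m)
      ≡⟨ cong (λ a → g * a + g * (a - g * starPoly m))
              (starPoly-cong (λ c′ → cong (λ a → indicator a c′ ℕ.+ m c′) t₀≡t₁)) ⟨
    g * starPoly (addOne c m) + g * (starPoly (addOne c m) - g * starPoly m)
      ≡⟨ starPoly-repeated c m ⟨
    starPoly (addOne c (addOne c m))
      ≡⟨ starPoly-cong (λ c′ → cong (λ a → indicator c c′ ℕ.+ (indicator a c′ ℕ.+ m c′)) t₀≡t₁) ⟩
    starPoly (occurrences t) ∎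
    where
    open ≡-Reasoning
    c = t zero
    g = G c
    m = occurrences (tail (tail t))

  Injective : ∀ {k} → (Fin k → Class) → Set
  Injective t = ∀ i j → t i ≡ t j → i ≡ j

  Injective-tail : ∀ {k} {t : Fin (suc k) → Class} → Injective t → Injective (tail t)
  Injective-tail t-inj i j eq = suc-injective (t-inj (suc i) (suc j) eq)

  Injective-moveToFront : ∀ {k} {t : Fin (suc k) → Class} j → Injective t → Injective (t ∘ moveToFront j)
  Injective-moveToFront j t-inj a b eq = moveToFront-injective j a b (t-inj _ _ eq)

  -- Vertices of pairwise distinct classes: without a central vertex every vertex is isolated,
  -- otherwise the central vertex is moved to position 1, next to a vertex pendant on it.
  starFormula-injective : ∀ k (t : Fin k → Class) → Injective t → StarFormula k t
  starFormula-injective zero    t _     = refl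
  starFormula-injective (suc k) t t-inj with any? (λ p → t p ≟ central)
  ... | no no-central = starFormula-isolated k t (λ eq → no-central (zero , eq)) (λ j eq → no-central (suc j , eq))
                          (λ j eq → 0≢1+n (sym (t-inj (suc j) zero eq))) (starFormula-injective k (tail t) (Injective-tail t-inj))
  ... | yes (p , tₚ≡0) = with-central k t t-inj p tₚ≡0
    where
    with-central : ∀ k (t : Fin (suc k) → Class) → Injective t → ∀ p → t p ≡ central → StarFormula (suc k) t
    with-central zero    t _     zero tₚ≡0 = starFormula-single t tₚ≡0
    with-central (suc k) t t-inj p tₚ≡0 =
      starFormula-moveToFront (suc k) t p (starFormula-moveToFront (suc k) (t ∘ moveToFront p) (suc zero)
        (starFormula-pendant k t″ u≢0 tₚ≡0 rest≢0 rest≢u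
          (starFormula-injective (suc k) (tail t″) (Injective-tail t″-inj))
          (starFormula-injective k (tail (tail t″)) (Injective-tail (Injective-tail t″-inj)))))
      where
      t″ : Fin (suc (suc k)) → Class
      t″ = t ∘ moveToFront p ∘ moveToFront (suc zero)
      t″-inj : Injective t″
      t″-inj = Injective-moveToFront (suc zero) (Injective-moveToFront p t-inj)
      u≢0 : t″ zero ≢ central
      u≢0 eq with t″-inj zero (suc zero) (trans eq (sym tₚ≡0))
      ... | ()
      rest≢0 : ∀ j → t″ (suc (suc j)) ≢ central
      rest≢0 j eq with t″-inj (suc (suc j)) (suc zero) (trans eq (sym tₚ≡0))
      ... | ()
      rest≢u : ∀ j → t″ (suc (suc j)) ≢ t″ zero
      rest≢u j eq with t″-inj (suc (suc j)) zero eq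
      ... | ()

  HasRepeat : ∀ {k} → (Fin k → Class) → Set
  HasRepeat t = ∃₂ λ i j → i ≢ j × t i ≡ t j

  ¬HasRepeat⇒Injective : ∀ {k} {t : Fin k → Class} → ¬ HasRepeat t → Injective t
  ¬HasRepeat⇒Injective no-repeat i j tᵢ≡tⱼ with i ≟ j
  ... | yes i≡j = i≡j
  ... | no  i≢j = ⊥-elim (no-repeat (i , j , i≢j , tᵢ≡tⱼ))

  -- A repeated class is moved to positions 0 and 1.
  starFormula-repeat : ∀ k (t : Fin (suc (suc k)) → Class) → (∀ u → StarFormula (suc k) u) → (∀ u → StarFormula k u) →
    HasRepeat t → StarFormula (suc (suc k)) t
  starFormula-repeat k t formula₁ formula₂ (i , j , i≢j , tᵢ≡tⱼ) =
    starFormula-moveToFront (suc k) t i (starFormula-moveToFront (suc k) (t ∘ moveToFront i) (suc (punchOut i≢j))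
      (starFormula-repeated k t″ (trans (cong t (punchIn-punchOut i≢j)) (sym tᵢ≡tⱼ))
                             (formula₁ (tail t″)) (formula₂ (tail (tail t″)))))
    where
    t″ : Fin (suc (suc k)) → Class
    t″ = t ∘ moveToFront i ∘ moveToFront (suc (punchOut i≢j))

  typedDet-star : ∀ k (t : Fin k → Class) → StarFormula k t
  typedDet-star zero          t = refl
  typedDet-star (suc zero)    t = starFormula-injective 1 t (λ { zero zero _ → refl })
  typedDet-star (suc (suc k)) t =
    by-cases (typedDet-star (suc k)) (typedDet-star k) (any? (λ i → any? (λ j → ¬? (i ≟ j) ×-dec (t i ≟ t j))))
    where
    by-cases : (∀ u → StarFormula (suc k) u) → (∀ u → StarFormula k u) → Dec (HasRepeat t) → StarFormula (suc (suc k)) t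
    by-cases formula₁ formula₂ (yes repeat)    = starFormula-repeat k t formula₁ formula₂ repeat
    by-cases formula₁ formula₂ (no  no-repeat) = starFormula-injective (suc (suc k)) t (¬HasRepeat⇒Injective no-repeat)

δ≡indicator : ∀ a b → δ a b ≡ + indicator a b
δ≡indicator a b with a ≟ b
... | yes _ = refl
... | no  _ = refl

Σ-byClass : ∀ k (t : Fin k → Class) (f : Class → ℤ) → Σ k (λ i → f (t i)) ≡ Σ 4 (λ c → f c * + occurrences t c)
Σ-byClass zero    t f = solve-zero (f central) (f rotation) (f reflection₀) (f reflection₁)
  where solve-zero : ∀ a b c d → + 0 ≡ a * + 0 + (b * + 0 + (c * + 0 + (d * + 0 + + 0)))
        solve-zero = solve-∀
Σ-byClass (suc k) t f = begin
  f (t zero) + Σ k (λ i → f (tail t i))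
    ≡⟨ cong₂ _+_ (Σ-sift 4 (t zero) f) (sym (Σ-byClass k (tail t) f)) ⟨
  Σ 4 (λ c → δ (t zero) c * f c) + Σ 4 (λ c → f c * + occurrences (tail t) c)
    ≡⟨ Σ-+ 4 (λ c → δ (t zero) c * f c) (λ c → f c * + occurrences (tail t) c) ⟨
  Σ 4 (λ c → δ (t zero) c * f c + f c * + occurrences (tail t) c)
    ≡⟨ Σ-cong 4 (λ c → trans (cong (λ d → d * f c + f c * + occurrences (tail t) c) (δ≡indicator (t zero) c))
                             (sym (distrib (f c) (indicator (t zero) c) (occurrences (tail t) c)))) ⟩
  Σ 4 (λ c → f c * + occurrences t c) ∎
  where
  open ≡-Reasoning
  distrib : ∀ x a b → x * + (a ℕ.+ b) ≡ + a * x + x * + b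
  distrib x a b =
    trans (cong (x *_) (ℤP.pos-+ a b)) (trans (ℤP.*-distribˡ-+ x (+ a) (+ b)) (cong (_+ x * + b) (ℤP.*-comm x (+ a))))

module ClassedGraph {k} (t : Fin k → Class) (F : Class → Class → ℤ)
  (F-refl : ∀ c → F c c ≡ + 1) (F-01 : ∀ a b → F a b ≡ + 0 ⊎ F a b ≡ + 1)
  (R : Fin k → Fin k → Set) (R⇒≢ : ∀ i j → R i j → i ≢ j)
  (R⇒F : ∀ i j → R i j → F (t i) (t j) ≡ + 1) (F⇒R : ∀ i j → i ≢ j → F (t i) (t j) ≡ + 1 → R i j)
  (A : Matrix k) (A-adj : IsAdjMatrix k R A) where

  closedDegree : Class → ℤ
  closedDegree c = Σ 4 (λ d → F c d * + occurrences t d)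

  adjacency : ∀ i j → A i j ≡ F (t i) (t j) - δ i j
  adjacency i j = by-cases (i ≟ j) (A-adj i j)
    where
    by-cases : Dec (i ≡ j) → (A i j ≡ + 1 × R i j) ⊎ (A i j ≡ + 0 × ¬ R i j) → A i j ≡ F (t i) (t j) - δ i j
    by-cases (yes refl) (inj₁ (_ , Rᵢᵢ))     = ⊥-elim (R⇒≢ i i Rᵢᵢ refl)
    by-cases (yes refl) (inj₂ (Aᵢᵢ≡0 , _))   = trans Aᵢᵢ≡0 (sym (cong₂ _-_ (F-refl (t i)) (δ-refl i)))
    by-cases (no i≢j)   (inj₁ (Aᵢⱼ≡1 , Rᵢⱼ)) = trans Aᵢⱼ≡1 (sym (cong₂ _-_ (R⇒F i j Rᵢⱼ) (δ-≢ i≢j)))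
    by-cases (no i≢j)   (inj₂ (Aᵢⱼ≡0 , ¬Rᵢⱼ)) with F-01 (t i) (t j)
    ... | inj₁ F≡0 = trans Aᵢⱼ≡0 (sym (cong₂ _-_ F≡0 (δ-≢ i≢j)))
    ... | inj₂ F≡1 = ⊥-elim (¬Rᵢⱼ (F⇒R i j i≢j F≡1))

  degree : ∀ i → Σ k (A i) ≡ closedDegree (t i) - + 1
  degree i = begin
    Σ k (A i)                               ≡⟨ Σ-cong k (adjacency i) ⟩
    Σ k (λ j → F (t i) (t j) - δ i j)        ≡⟨ Σ-difference k (λ j → F (t i) (t j)) (δ i) ⟩
    Σ k (λ j → F (t i) (t j)) - Σ k (δ i)    ≡⟨ cong₂ _-_ (Σ-byClass k t (F (t i))) Σδ≡1 ⟩
    closedDegree (t i) - + 1                 ∎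
    where
    open ≡-Reasoning
    Σδ≡1 : Σ k (δ i) ≡ + 1
    Σδ≡1 = trans (Σ-cong k (λ j → sym (ℤP.*-identityʳ (δ i j)))) (Σ-sift k i (λ _ → + 1))

  charPoly≡typedDet : ∀ x → charPoly k (laplacian k A) x ≡ TypedMatrix.typedDet (λ c → x - closedDegree c) F k t
  charPoly≡typedDet x = det-cong k λ i j → begin
    x * δ i j - (δ i j * Σ k (A i) - A i j)
      ≡⟨ cong₂ (λ d a → x * δ i j - (δ i j * d - a)) (degree i) (adjacency i j) ⟩
    x * δ i j - (δ i j * (closedDegree (t i) - + 1) - (F (t i) (t j) - δ i j))
      ≡⟨ ring x (δ i j) (closedDegree (t i)) (F (t i) (t j)) ⟩
    δ i j * (x - closedDegree (t i)) + F (t i) (t j) ∎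
    where
    open ≡-Reasoning
    ring : ∀ x d s f → x * d - (d * (s - + 1) - (f - d)) ≡ d * (x - s) + f
    ring = solve-∀

module Spectrum (m : ℕ) (x : ℤ) where

  n : ℕ
  n = suc (suc m)

  open StarDeterminant

  private
    exponent₂ : 2 ℕ.* n ℕ.∸ 2 ≡ suc m ℕ.+ suc m
    exponent₂ = cong (ℕ._∸ 2) (ring m)
      where ring : ∀ m → 2 ℕ.* suc (suc m) ≡ 2 ℕ.+ (suc m ℕ.+ suc m)
            ring = ℕ-Solver.solve-∀
    exponent₃ : 2 ℕ.* n ℕ.∸ 3 ≡ m ℕ.+ suc m
    exponent₃ = cong (ℕ._∸ 3) (ring m)
      where ring : ∀ m → 2 ℕ.* suc (suc m) ≡ 3 ℕ.+ (m ℕ.+ suc m)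
            ring = ℕ-Solver.solve-∀

    -- starPoly on the class sizes with the clique determinants in closed form, where
    -- P = g₁ ^ (2n - 3), Q = g₂ ^ (n - 1) and A₄, A₂, Aₙ stand for 4n, 2n and n + 2.
    spectrum-identity : ∀ x k P Q A₄ A₂ Aₙ → A₄ ≡ + 4 * (+ 2 + k) → A₂ ≡ + 2 * (+ 2 + k) → Aₙ ≡ + 2 + k + + 2 →
      let g₀ = x - A₄; g₁ = x - A₂; g₂ = x - Aₙ; c₁ = + 1 + k + (+ 1 + k); c₂ = + 2 + k
          h₀ = g₀ ^ 1 * (g₀ + + 2); k₀ = + 2 * g₀ ^ 1
          h₁ = P * (g₁ + c₁); k₁ = c₁ * P
          h₂ = Q * (g₂ + c₂); k₂ = c₂ * Q
      in h₀ * h₁ * h₂ * h₂ - k₀ * (k₁ * h₂ * h₂ + h₁ * k₂ * h₂ + h₁ * h₂ * k₂)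
           ≡ x * (x - + 2) ^ 2 * (Q * Q) * g₀ ^ 2 * P
    spectrum-identity x k P Q _ _ _ refl refl refl = ring x k P Q
      where
      ring : ∀ x k P Q →
        let g₀ = x - + 4 * (+ 2 + k); g₁ = x - + 2 * (+ 2 + k); g₂ = x - (+ 2 + k + + 2)
            c₁ = + 1 + k + (+ 1 + k); c₂ = + 2 + k
            h₀ = g₀ * + 1 * (g₀ + + 2); k₀ = + 2 * (g₀ * + 1)
            h₁ = P * (g₁ + c₁); k₁ = c₁ * P
            h₂ = Q * (g₂ + c₂); k₂ = c₂ * Q
        in h₀ * h₁ * h₂ * h₂ - k₀ * (k₁ * h₂ * h₂ + h₁ * k₂ * h₂ + h₁ * h₂ * k₂)
             ≡ x * ((x - + 2) * ((x - + 2) * + 1)) * (Q * Q) * (g₀ * (g₀ * + 1)) * P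
      ring = solve-∀

  starPoly-sizes : ∀ (G : Class → ℤ) → G central ≡ x - + (4 ℕ.* n) → G rotation ≡ x - + (2 ℕ.* n) →
    G reflection₀ ≡ x - + (n ℕ.+ 2) → G reflection₁ ≡ x - + (n ℕ.+ 2) →
    starPoly G (classSize (suc m)) ≡ x * (x - + 2) ^ 2 * (x - + (n ℕ.+ 2)) ^ (2 ℕ.* n ℕ.∸ 2)
                         * (x - + (4 ℕ.* n)) ^ 2 * (x - + (2 ℕ.* n)) ^ (2 ℕ.* n ℕ.∸ 3)
  starPoly-sizes G G₀ G₁ G₂ G₃
    rewrite G₀ | G₁ | G₂ | G₃
          | cliqueDet-closed (x - + (4 ℕ.* n)) 1 | cliqueCofactors-closed (x - + (4 ℕ.* n)) 1
          | cliqueDet-closed (x - + (2 ℕ.* n)) (m ℕ.+ suc m) | cliqueCofactors-closed (x - + (2 ℕ.* n)) (m ℕ.+ suc m)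
          | cliqueDet-closed (x - + (n ℕ.+ 2)) (suc m) | cliqueCofactors-closed (x - + (n ℕ.+ 2)) (suc m) =
    trans (spectrum-identity x (+ m) P Q (+ (4 ℕ.* n)) (+ (2 ℕ.* n)) (+ (n ℕ.+ 2)) (ℤP.pos-* 4 n) (ℤP.pos-* 2 n) (ℤP.pos-+ n 2))
          (cong₂ (λ a b → x * (x - + 2) ^ 2 * a * (x - + (4 ℕ.* n)) ^ 2 * b) Q²≡ P≡)
    where
    P Q : ℤ
    P = (x - + (2 ℕ.* n)) ^ (m ℕ.+ suc m)
    Q = (x - + (n ℕ.+ 2)) ^ suc m
    Q²≡ : Q * Q ≡ (x - + (n ℕ.+ 2)) ^ (2 ℕ.* n ℕ.∸ 2)
    Q²≡ = sym (trans (cong ((x - + (n ℕ.+ 2)) ^_) exponent₂) (ℤP.^-distribˡ-+-* (x - + (n ℕ.+ 2)) (suc m) (suc m)))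
    P≡ : P ≡ (x - + (2 ℕ.* n)) ^ (2 ℕ.* n ℕ.∸ 3)
    P≡ = cong ((x - + (2 ℕ.* n)) ^_) (sym exponent₃)

  starClosedDegree : Class → ℤ
  starClosedDegree c = Σ 4 (λ d → starAdj c d * + classSize (suc m) d)

  starClosedDegree-central : starClosedDegree central ≡ + (4 ℕ.* n)
  starClosedDegree-central = trans (ring (+ m)) (sym (ℤP.pos-* 4 n))
    where ring : ∀ k → + 1 * + 2 + (+ 1 * (+ 1 + k + (+ 1 + k)) + (+ 1 * (+ 2 + k) + (+ 1 * (+ 2 + k) + + 0)))
                       ≡ + 4 * (+ 2 + k)
          ring = solve-∀

  starClosedDegree-rotation : starClosedDegree rotation ≡ + (2 ℕ.* n)
  starClosedDegree-rotation = trans (ring (+ m)) (sym (ℤP.pos-* 2 n))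
    where ring : ∀ k → + 1 * + 2 + (+ 1 * (+ 1 + k + (+ 1 + k)) + (+ 0 * (+ 2 + k) + (+ 0 * (+ 2 + k) + + 0)))
                       ≡ + 2 * (+ 2 + k)
          ring = solve-∀

  starClosedDegree-reflection₀ : starClosedDegree reflection₀ ≡ + (n ℕ.+ 2)
  starClosedDegree-reflection₀ = trans (ring (+ m)) (sym (ℤP.pos-+ n 2))
    where ring : ∀ k → + 1 * + 2 + (+ 0 * (+ 1 + k + (+ 1 + k)) + (+ 1 * (+ 2 + k) + (+ 0 * (+ 2 + k) + + 0)))
                       ≡ + 2 + k + + 2
          ring = solve-∀

  starClosedDegree-reflection₁ : starClosedDegree reflection₁ ≡ + (n ℕ.+ 2)
  starClosedDegree-reflection₁ = trans (ring (+ m)) (sym (ℤP.pos-+ n 2))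
    where ring : ∀ k → + 1 * + 2 + (+ 0 * (+ 1 + k + (+ 1 + k)) + (+ 0 * (+ 2 + k) + (+ 1 * (+ 2 + k) + + 0)))
                       ≡ + 2 + k + + 2
          ring = solve-∀

mainTheorem10 : (n : ℕ) .{{_ : NonZero n}} → 2 ≤ n → 2 ∣ n →
    (A : Matrix (N n)) → IsAdjMatrix (N n) (Adj n) A →
    (x : ℤ) →
      charPoly (N n) (laplacian (N n) A) x
        ≡ x ℤ.* (x - + 2) ^ 2 ℤ.* (x - + (n ℕ.+ 2)) ^ (2 ℕ.* n ℕ.∸ 2)
            ℤ.* (x - + (4 ℕ.* n)) ^ 2 ℤ.* (x - + (2 ℕ.* n)) ^ (2 ℕ.* n ℕ.∸ 3)
mainTheorem10 n@(suc (suc m)) (s≤s (s≤s z≤n)) n-even A A-adj x = begin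
  charPoly (N n) (laplacian (N n) A) x  ≡⟨ charPoly≡typedDet x ⟩
  typedDet (N n) vertexClass            ≡⟨ typedDet-star (N n) vertexClass ⟩
  starPoly (occurrences vertexClass)    ≡⟨ starPoly-cong occurrences-vertexClass ⟩
  starPoly (classSize (suc m))          ≡⟨ starPoly-sizes G (G≡ central starClosedDegree-central)
                                             (G≡ rotation starClosedDegree-rotation) (G≡ reflection₀ starClosedDegree-reflection₀)
                                             (G≡ reflection₁ starClosedDegree-reflection₁) ⟩
  x * (x - + 2) ^ 2 * (x - + (n ℕ.+ 2)) ^ (2 ℕ.* n ℕ.∸ 2)
    * (x - + (4 ℕ.* n)) ^ 2 * (x - + (2 ℕ.* n)) ^ (2 ℕ.* n ℕ.∸ 3) ∎
  where
  open ≡-Reasoning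
  open Dicyclic n n-even using (vertexClass; Adj⇒starAdj; starAdj⇒Adj)
  open ClassSizes (suc m) n-even using (occurrences-vertexClass)
  open ClassedGraph vertexClass starAdj starAdj-refl starAdj-01 (Adj n) (λ _ _ → proj₁) Adj⇒starAdj starAdj⇒Adj A A-adj
    using (closedDegree; charPoly≡typedDet)
  open Spectrum m x hiding (n)
  G : Class → ℤ
  G c = x - closedDegree c
  open StarDeterminant G using (typedDet; typedDet-star; starPoly; starPoly-cong)
  G≡ : ∀ c {v} → starClosedDegree c ≡ v → G c ≡ x - v
  G≡ c deg = cong (_-_ x) (trans (Σ-cong 4 (λ d → cong (λ s → starAdj c d * + s) (occurrences-vertexClass d))) deg)
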